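{- For every integer $n\geq 1$ there is a bijection $\Psi:\mathcal{DU}_n\to\mathcal{BT}_n$ such that for every $\pi\in\mathcal{DU}_n$, the first letter $\pi_1$ of $\pi$ equals $\textsc{Leaf}(\Psi(\pi))$, the leaf at the end of the minimal path of the tree $\Psi(\pi)$.
   Context: $[n]=\{1,\dots,n\}$. $\mathcal{DU}_n$ is the set of down-up permutations of $[n]$, i.e. permutations $\pi=\pi_1\pi_2\cdots\pi_n$ with $\pi_1>\pi_2<\pi_3>\pi_4<\cdots$. An increasing tree on $[n]$ is a tree with vertex set $[n]$, rooted at $1$, in which labels increase along every path going away from the root; for an edge $\{i,j\}$ with $i<j$, $i$ is the parent of $j$ and $j$ a child of $i$. Children are unordered. $\mathcal{BT}_n$ is the set of increasing trees on $[n]$ in which every vertex has at most two children. The minimal path of $T\in\mathcal{BT}_n$ is the sequence $a_1,\dots,a_\ell$ with $a_1=1$, $a_i$ the smallest child of $a_{i-1}$ for $i\ge 2$, and $a_\ell$ a leaf (a vertex with no child); $\textsc{Leaf}(T)=a_\ell$. -}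

module Defs where

open import Data.Nat using (ℕ; zero; suc; _≤_; _<_; _>_)
open import Data.List using (List; []; _∷_; map; upTo)
open import Data.List.Relation.Binary.Permutation.Propositional using (_↭_)
open import Data.Product using (_×_; Σ; ∃)
open import Data.Sum using (_⊎_)
open import Relation.Binary.PropositionalEquality using (_≡_)
open import Relation.Nullary using (¬_)

[_] : ℕ → List ℕ
[ n ] = map suc (upTo n)

mutual
  data Down : List ℕ → Set where
    d[]  : Down []
    d[_] : ∀ x → Down (x ∷ [])
    d∷   : ∀ {x y r} → x > y → Up (y ∷ r) → Down (x ∷ y ∷ r)

  data Up : List ℕ → Set where
    u[]  : Up []
    u[_] : ∀ x → Up (x ∷ [])
    u∷   : ∀ {x y r} → x < y → Down (y ∷ r) → Up (x ∷ y ∷ r)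

-- DU_n : down-up permutations of [n], a permutation given in one-line notation
record DU (n : ℕ) : Set where
  field
    word   : List ℕ
    isPerm : word ↭ [ n ]
    downUp : Down word
open DU public

-- Increasing trees on [n], rooted at 1: every vertex j ∈ {2,…,n} has a
-- parent parent j with 1 ≤ parent j < j; the edges are {parent j , j}.
-- (Values of parent outside {2,…,n} are irrelevant junk.)
record IncTree (n : ℕ) : Set where
  field
    parent    : ℕ → ℕ
    parent-ok : ∀ j → 2 ≤ j → j ≤ n → 1 ≤ parent j × parent j < j
open IncTree public

Child : ∀ {n} → IncTree n → ℕ → ℕ → Set
Child {n} T i j = 2 ≤ j × j ≤ n × parent T j ≡ i

-- Two increasing trees on [n] are the same tree iff they have the same edges,
-- i.e. the same parent for every non-root vertex.
_≈T_ : ∀ {n} → IncTree n → IncTree n → Set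
_≈T_ {n} T T' = ∀ j → 2 ≤ j → j ≤ n → parent T j ≡ parent T' j

AtMostTwoChildren : ∀ {n} → IncTree n → Set
AtMostTwoChildren T =
  ∀ i j k l → Child T i j → Child T i k → Child T i l →
  j ≡ k ⊎ j ≡ l ⊎ k ≡ l

record BT (n : ℕ) : Set where
  field
    tree   : IncTree n
    binary : AtMostTwoChildren tree
open BT public

_≈B_ : ∀ {n} → BT n → BT n → Set
T ≈B T' = tree T ≈T tree T'

IsLeaf : ∀ {n} → IncTree n → ℕ → Set
IsLeaf T v = ∀ j → ¬ Child T v j

SmallestChild : ∀ {n} → IncTree n → ℕ → ℕ → Set
SmallestChild T a c = Child T a c × (∀ j → Child T a j → c ≤ j)

data MinPathEnd {n : ℕ} (T : IncTree n) : ℕ → ℕ → Set where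
  stop : ∀ {a} → IsLeaf T a → MinPathEnd T a a
  step : ∀ {a c v} → SmallestChild T a c → MinPathEnd T c v → MinPathEnd T a v

LeafIs : ∀ {n} → BT n → ℕ → Set
LeafIs T v = MinPathEnd (tree T) 1 v

module Submission where

-- A word of distinct labels is the inorder reading of a unique heap-ordered binary tree, and
-- the word is down-up exactly when every vertex of the heap that is not a leaf has a left
-- subtree, of odd size (Alt). Its first letter is the leftmost vertex of the heap.
--
-- An increasing tree with root m and subtrees s, t (s having the smaller root) is encoded by
-- recursion: if the heap a of s has odd size, a and the heap b of t become the subtrees of m;
-- otherwise m takes the place of the root μ of a and μ moves down into the right subtree,
-- adopting b as its left subtree when b has odd size, and otherwise a re-split of the rest of a
-- and of b into two odd heaps. In every case the leftmost vertex is that of a, so it is the end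
-- of the minimal path. Whether m displaced a root can be read off by comparing the roots of the
-- two subtrees of m, which inverts the encoding. Finally a tree on [n] is determined by its
-- parent function, since it is rebuilt by hanging 2, 3, …, n below their parents in turn.

open import Defs
open import Data.Bool using (Bool; true; false; not; _xor_)
open import Data.Empty using (⊥; ⊥-elim)
open import Data.List using (List; []; _∷_; _++_; length; map; upTo)
open import Data.List.Membership.Propositional using (_∈_; _∉_)
open import Data.List.Membership.Propositional.Properties using (∈-∃++)
open import Data.List.Properties using (length-++; upTo-∷ʳ; map-++; ∷-injective)
open import Data.List.Relation.Binary.Permutation.Propositional using (_↭_; ↭-sym; ↭-trans; prep)
open import Data.List.Relation.Binary.Permutation.Propositional.Properties using (shift; ↭-length)
open import Data.List.Relation.Unary.All as All using (All; []; _∷_)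
import Data.List.Relation.Unary.All.Properties as AllP
open import Data.List.Relation.Unary.Any using (here; there)
open import Data.Nat using (ℕ; zero; suc; _≤_; _<_; z≤n; s≤s; _≟_; _<?_; _≤?_; _+_)
open import Data.Nat.Properties
open import Data.Nat.Tactic.RingSolver using (solve-∀)
open import Data.Product using (_×_; Σ; ∃; _,_; proj₁; proj₂)
open import Data.Sum using (_⊎_; inj₁; inj₂; map₂)
open import Data.Unit using (⊤; tt)
open import Relation.Binary.Definitions using (tri<; tri≈; tri>)
open import Relation.Binary.PropositionalEquality hiding ([_])
open import Relation.Nullary using (¬_; yes; no; Dec)

-- Multisets of labels

δ : ℕ → ℕ → ℕ
δ a x with a ≟ x
... | yes _ = 1
... | no _ = 0

δ-refl : ∀ a → δ a a ≡ 1
δ-refl a with a ≟ a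
... | yes _ = refl
... | no a≢a = ⊥-elim (a≢a refl)

δ-≢ : ∀ {a b} → a ≢ b → δ a b ≡ 0
δ-≢ {a} {b} a≢b with a ≟ b
... | yes a≡b = ⊥-elim (a≢b a≡b)
... | no _ = refl

δ≤1 : ∀ a b → δ a b ≤ 1
δ≤1 a b with a ≟ b
... | yes _ = ≤-refl
... | no _ = z≤n

δ>0⇒≡ : ∀ {a b} → 0 < δ a b → a ≡ b
δ>0⇒≡ {a} {b} p with a ≟ b
... | yes a≡b = a≡b

count : List ℕ → ℕ → ℕ
count [] a = 0
count (x ∷ xs) a = δ a x + count xs a

count-++ : ∀ xs ys a → count (xs ++ ys) a ≡ count xs a + count ys a
count-++ [] ys a = refl
count-++ (x ∷ xs) ys a rewrite count-++ xs ys a = sym (+-assoc (δ a x) (count xs a) (count ys a))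

count-head>0 : ∀ x xs → 0 < count (x ∷ xs) x
count-head>0 x xs rewrite δ-refl x = s≤s z≤n

count>0⇒∈ : ∀ xs a → 0 < count xs a → a ∈ xs
count>0⇒∈ (x ∷ xs) a p with a ≟ x
... | yes a≡x = here a≡x
... | no _ = there (count>0⇒∈ xs a p)

∈⇒count>0 : ∀ {a} xs → a ∈ xs → 0 < count xs a
∈⇒count>0 (x ∷ xs) (here refl) = count-head>0 x xs
∈⇒count>0 {a} (x ∷ xs) (there p) = <-≤-trans (∈⇒count>0 xs p) (m≤n+m (count xs a) (δ a x))

↭⇒count≗ : ∀ {xs ys} → xs ↭ ys → count xs ≗ count ys
↭⇒count≗ _↭_.refl a = refl
↭⇒count≗ (_↭_.prep x p) a = cong (δ a x +_) (↭⇒count≗ p a)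
↭⇒count≗ (_↭_.swap x y p) a = trans (+-exchange (δ a x) (δ a y) _) (cong (λ n → δ a y + (δ a x + n)) (↭⇒count≗ p a))
  where +-exchange : ∀ p q r → p + (q + r) ≡ q + (p + r)
        +-exchange = solve-∀
↭⇒count≗ (_↭_.trans p q) a = trans (↭⇒count≗ p a) (↭⇒count≗ q a)

count≗⇒↭ : ∀ xs ys → count xs ≗ count ys → xs ↭ ys
count≗⇒↭ [] [] e = _↭_.refl
count≗⇒↭ [] (y ∷ ys) e = ⊥-elim (<-irrefl (e y) (count-head>0 y ys))
count≗⇒↭ (x ∷ xs) ys e with ∈-∃++ (count>0⇒∈ ys x (subst (0 <_) (e x) (count-head>0 x xs)))
... | ys₁ , ys₂ , refl = ↭-trans (prep x (count≗⇒↭ xs (ys₁ ++ ys₂) rest)) (↭-sym (shift x ys₁ ys₂))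
  where
  rest : count xs ≗ count (ys₁ ++ ys₂)
  rest a = +-cancelˡ-≡ (δ a x) _ _ (begin
    δ a x + count xs a                       ≡⟨ e a ⟩
    count (ys₁ ++ x ∷ ys₂) a                 ≡⟨ count-++ ys₁ (x ∷ ys₂) a ⟩
    count ys₁ a + (δ a x + count ys₂ a)      ≡⟨ +-exchange (count ys₁ a) (δ a x) (count ys₂ a) ⟩
    δ a x + (count ys₁ a + count ys₂ a)      ≡⟨ cong (δ a x +_) (count-++ ys₁ ys₂ a) ⟨
    δ a x + count (ys₁ ++ ys₂) a             ∎)
    where open ≡-Reasoning
          +-exchange : ∀ p q r → p + (q + r) ≡ q + (p + r)
          +-exchange = solve-∀

count≗⇒length≡ : ∀ xs ys → count xs ≗ count ys → length xs ≡ length ys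
count≗⇒length≡ xs ys e = ↭-length (count≗⇒↭ xs ys e)

Bag : Set
Bag = ℕ → ℕ

⟦_⟧ : ℕ → Bag
⟦ m ⟧ a = δ a m

_⊕_ : Bag → Bag → Bag
(f ⊕ g) a = f a + g a

infixr 6 _⊕_

Every : (ℕ → Set) → Bag → Set
Every P f = ∀ a → 0 < f a → P a

Distinct : Bag → Set
Distinct f = ∀ a → f a ≤ 1

Every-⊕ˡ : ∀ {P f g} → Every P (f ⊕ g) → Every P f
Every-⊕ˡ {f = f} {g} h a p = h a (<-≤-trans p (m≤m+n (f a) (g a)))

Every-⊕ʳ : ∀ {P f g} → Every P (f ⊕ g) → Every P g
Every-⊕ʳ {f = f} {g} h a p = h a (<-≤-trans p (m≤n+m (g a) (f a)))

Every-⊕ : ∀ {P f g} → Every P f → Every P g → Every P (f ⊕ g)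
Every-⊕ {f = f} hf hg a p with f a | hf a
... | zero | _ = hg a p
... | suc _ | pa = pa (s≤s z≤n)

Every-≗ : ∀ {P f g} → f ≗ g → Every P g → Every P f
Every-≗ e h a p = h a (subst (0 <_) (e a) p)

Every-mono : ∀ {P Q : ℕ → Set} {f} → (∀ {a} → P a → Q a) → Every P f → Every Q f
Every-mono P⇒Q h a p = P⇒Q (h a p)

Every-δ+ : ∀ {P : ℕ → Set} {m f} → P m → Every P f → Every P (λ a → δ a m + f a)
Every-δ+ {m = m} pm hf a p with a ≟ m
... | yes refl = pm
... | no _ = hf a p

Distinct-mono : ∀ {f g} → Distinct f → (∀ a → g a ≤ f a) → Distinct g
Distinct-mono u le a = ≤-trans (le a) (u a)

Distinct-≗ : ∀ {f g} → f ≗ g → Distinct g → Distinct f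
Distinct-≗ e u a = subst (_≤ 1) (sym (e a)) (u a)

Distinct-⊕ˡ : ∀ {f g} → Distinct (f ⊕ g) → Distinct f
Distinct-⊕ˡ {f} {g} u = Distinct-mono u (λ a → m≤m+n (f a) (g a))

Distinct-⊕ʳ : ∀ {f g} → Distinct (f ⊕ g) → Distinct g
Distinct-⊕ʳ {f} {g} u = Distinct-mono u (λ a → m≤n+m (g a) (f a))

Distinct-⊕-mono : ∀ {f g f′ g′} → Distinct (f ⊕ g) → (∀ a → f′ a ≤ f a) → (∀ a → g′ a ≤ g a) → Distinct (f′ ⊕ g′)
Distinct-⊕-mono u p q = Distinct-mono u (λ a → +-mono-≤ (p a) (q a))

Distinct-⊕⇒≢ : ∀ {f g a b} → Distinct (f ⊕ g) → 0 < f a → 0 < g b → a ≢ b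
Distinct-⊕⇒≢ {a = a} u p q refl = <⇒≱ (+-mono-≤ p q) (u a)

Distinct-++ˡ : ∀ xs ys → Distinct (count (xs ++ ys)) → Distinct (count xs)
Distinct-++ˡ xs ys u = Distinct-mono u (λ a → subst (count xs a ≤_) (sym (count-++ xs ys a)) (m≤m+n _ _))

Distinct-++ʳ : ∀ xs ys → Distinct (count (xs ++ ys)) → Distinct (count ys)
Distinct-++ʳ xs ys u = Distinct-mono u (λ a → subst (count ys a ≤_) (sym (count-++ xs ys a)) (m≤n+m _ _))

+-pos-split : ∀ x y → 0 < x + y → 0 < x ⊎ 0 < y
+-pos-split zero y p = inj₂ p
+-pos-split (suc x) y p = inj₁ (s≤s z≤n)

Every⇒All : ∀ {P : ℕ → Set} xs → Every P (count xs) → All P xs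
Every⇒All [] h = []
Every⇒All (x ∷ xs) h = h x (count-head>0 x xs) ∷ Every⇒All xs (λ a p → h a (<-≤-trans p (m≤n+m (count xs a) (δ a x))))

All⇒Every : ∀ {P : ℕ → Set} xs → All P xs → Every P (count xs)
All⇒Every xs h a p = All.lookup h (count>0⇒∈ xs a p)

Every<⇒∉ : ∀ {m} xs → Every (m <_) (count xs) → m ∉ xs
Every<⇒∉ {m} xs h p = <-irrefl refl (h m (∈⇒count>0 xs p))

[n]-suc : ∀ n → [ suc n ] ≡ [ n ] ++ suc n ∷ []
[n]-suc n = trans (cong (map suc) (sym (upTo-∷ʳ n))) (map-++ suc (upTo n) (n ∷ []))

count-[n]-suc : ∀ n a → count [ suc n ] a ≡ count [ n ] a + (δ a (suc n) + 0)
count-[n]-suc n a = trans (cong (λ l → count l a) ([n]-suc n)) (count-++ [ n ] (suc n ∷ []) a)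

count-[n]-out : ∀ n a → a ≡ 0 ⊎ n < a → count [ n ] a ≡ 0
count-[n]-out zero a _ = refl
count-[n]-out (suc n) a h rewrite count-[n]-suc n a | count-[n]-out n a (map₂ (<-trans (n<1+n n)) h) with a ≟ suc n
... | no _ = refl
count-[n]-out (suc n) .(suc n) (inj₁ ()) | yes refl
count-[n]-out (suc n) .(suc n) (inj₂ lt) | yes refl = ⊥-elim (<-irrefl refl lt)

count-[n]-in : ∀ n a → 1 ≤ a → a ≤ n → count [ n ] a ≡ 1
count-[n]-in zero .zero () z≤n
count-[n]-in (suc n) a p q rewrite count-[n]-suc n a with a ≟ suc n
... | yes refl rewrite count-[n]-out n (suc n) (inj₂ ≤-refl) = refl
... | no ne rewrite count-[n]-in n a p (≤-pred (≤∧≢⇒< q ne)) = refl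

Distinct-[n] : ∀ n → Distinct (count [ n ])
Distinct-[n] n zero rewrite count-[n]-out n 0 (inj₁ refl) = z≤n
Distinct-[n] n (suc a) with suc a ≤? n
... | yes le rewrite count-[n]-in n (suc a) (s≤s z≤n) le = ≤-refl
... | no nle rewrite count-[n]-out n (suc a) (inj₂ (≰⇒> nle)) = z≤n

count-[n]>0 : ∀ n a → 0 < count [ n ] a → 1 ≤ a × a ≤ n
count-[n]>0 n zero p rewrite count-[n]-out n 0 (inj₁ refl) = ⊥-elim (<-irrefl refl p)
count-[n]>0 n (suc a) p with suc a ≤? n
... | yes le = s≤s z≤n , le
... | no nle rewrite count-[n]-out n (suc a) (inj₂ (≰⇒> nle)) = ⊥-elim (<-irrefl refl p)

-- Binary trees, heap ordered, read in inorder

data BinTree : Set where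
  ∅ : BinTree
  node : BinTree → ℕ → BinTree → BinTree

inorder : BinTree → List ℕ
inorder ∅ = []
inorder (node l m r) = inorder l ++ m ∷ inorder r

root : BinTree → ℕ
root ∅ = 0
root (node _ m _) = m

leftmost : BinTree → ℕ
leftmost ∅ = 0
leftmost (node ∅ m r) = m
leftmost (node (node a b c) m r) = leftmost (node a b c)

IsNode : BinTree → Set
IsNode x = ∃ λ l → ∃ λ m → ∃ λ r → x ≡ node l m r

size : BinTree → ℕ
size x = length (inorder x)

size-node : ∀ l m r → size (node l m r) ≡ size l + suc (size r)
size-node l m r = length-++ (inorder l)

size-node>0 : ∀ l m r → 0 < size (node l m r)
size-node>0 l m r rewrite size-node l m r = ≤-trans (s≤s z≤n) (m≤n+m _ (size l))

bag : BinTree → Bag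
bag x = count (inorder x)

bag-node : ∀ l m r → bag (node l m r) ≗ bag l ⊕ ⟦ m ⟧ ⊕ bag r
bag-node l m r a = count-++ (inorder l) (m ∷ inorder r) a

bag-swallowˡ : ∀ y m → bag (node y m ∅) ⊕ bag ∅ ≗ bag (node ∅ m ∅) ⊕ bag y
bag-swallowˡ y m a rewrite bag-node y m ∅ a | bag-node ∅ m ∅ a = shuffle (bag y a) (δ a m)
  where shuffle : ∀ p q → (p + (q + 0)) + 0 ≡ (0 + (q + 0)) + p
        shuffle = solve-∀

bag-swallowʳ : ∀ x m → bag ∅ ⊕ bag (node x m ∅) ≗ bag x ⊕ bag (node ∅ m ∅)
bag-swallowʳ x m a rewrite bag-node x m ∅ a | bag-node ∅ m ∅ a = shuffle (bag x a) (δ a m)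
  where shuffle : ∀ p q → 0 + (p + (q + 0)) ≡ p + (0 + (q + 0))
        shuffle = solve-∀

bag-replaceʳ : ∀ l m r e (d y : Bag) → bag e ⊕ d ≗ bag r ⊕ y → bag (node l m e) ⊕ d ≗ bag (node l m r) ⊕ y
bag-replaceʳ l m r e d y h a rewrite bag-node l m e a | bag-node l m r a =
  trans (regroup (bag l a) (δ a m) (bag e a) (d a)) (trans (cong (bag l a + δ a m +_) (h a)) (sym (regroup (bag l a) (δ a m) (bag r a) (y a))))
  where regroup : ∀ p q s t → (p + (q + s)) + t ≡ (p + q) + (s + t)
        regroup = solve-∀

bag-replaceʳ′ : ∀ l m r e (g x : Bag) → g ⊕ bag e ≗ x ⊕ bag r → g ⊕ bag (node l m e) ≗ x ⊕ bag (node l m r)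
bag-replaceʳ′ l m r e g x h a rewrite bag-node l m e a | bag-node l m r a =
  trans (regroup (g a) (bag l a) (δ a m) (bag e a)) (trans (cong (bag l a + δ a m +_) (h a)) (sym (regroup (x a) (bag l a) (δ a m) (bag r a))))
  where regroup : ∀ p q s t → p + (q + (s + t)) ≡ (q + s) + (p + t)
        regroup = solve-∀

root∈bag : ∀ l m r → 0 < bag (node l m r) m
root∈bag l m r rewrite bag-node l m r m | δ-refl m = <-≤-trans (s≤s z≤n) (m≤n+m (suc (bag r m)) (bag l m))

bag-left≤ : ∀ l m r a → bag l a ≤ bag (node l m r) a
bag-left≤ l m r a rewrite bag-node l m r a = m≤m+n _ _

bag-right≤ : ∀ l m r a → bag r a ≤ bag (node l m r) a
bag-right≤ l m r a rewrite bag-node l m r a = ≤-trans (m≤n+m (bag r a) (δ a m)) (m≤n+m _ (bag l a))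

Distinct-children : ∀ l m r → Distinct (bag (node l m r)) → Distinct (bag l ⊕ bag r)
Distinct-children l m r u = Distinct-mono u (λ a → subst (bag l a + bag r a ≤_) (sym (bag-node l m r a)) (+-monoʳ-≤ (bag l a) (m≤n+m _ (δ a m))))

Every-∅ : ∀ {P} → Every P (bag ∅)
Every-∅ a ()

Every-node : ∀ {P l m r} → Every P (bag l) → P m → Every P (bag r) → Every P (bag (node l m r))
Every-node {l = l} {m} {r} hl pm hr a p with m ≟ a
... | yes refl = pm
... | no m≢a = Every-⊕ hl hr a (subst (0 <_) (trans (bag-node l m r a) (cong (λ k → bag l a + (k + bag r a)) (δ-≢ (≢-sym m≢a)))) p)

Every-nodeˡ : ∀ {P l m r} → Every P (bag (node l m r)) → Every P (bag l)
Every-nodeˡ {l = l} {m} {r} h a p = h a (<-≤-trans p (bag-left≤ l m r a))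

Every-nodeʳ : ∀ {P l m r} → Every P (bag (node l m r)) → Every P (bag r)
Every-nodeʳ {l = l} {m} {r} h a p = h a (<-≤-trans p (bag-right≤ l m r a))

Every-node-root : ∀ {P l m r} → Every P (bag (node l m r)) → P m
Every-node-root {l = l} {m} {r} h = h m (root∈bag l m r)

Heap : BinTree → Set
Heap ∅ = ⊤
Heap (node l m r) = Every (m <_) (bag l) × Every (m <_) (bag r) × Heap l × Heap r

Heap-root≤ : ∀ x → Heap x → Every (root x ≤_) (bag x)
Heap-root≤ ∅ _ = Every-∅
Heap-root≤ (node l m r) (hl , hr , _) = Every-node {l = l} {m} {r} (Every-mono <⇒≤ hl) ≤-refl (Every-mono <⇒≤ hr)

Heap-root< : ∀ {k} y → Heap y → k < root y → Every (k <_) (bag y)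
Heap-root< y hy lt = Every-mono (<-≤-trans lt) (Heap-root≤ y hy)

≮∧≢⇒> : ∀ {m n} → ¬ m < n → m ≢ n → n < m
≮∧≢⇒> m≮n m≢n = ≤∧≢⇒< (≮⇒≥ m≮n) (≢-sym m≢n)

distinct-roots : ∀ l₁ m₁ r₁ l₂ m₂ r₂ → Distinct (bag (node l₁ m₁ r₁) ⊕ bag (node l₂ m₂ r₂)) → m₁ ≢ m₂
distinct-roots l₁ m₁ r₁ l₂ m₂ r₂ u = Distinct-⊕⇒≢ {bag (node l₁ m₁ r₁)} {bag (node l₂ m₂ r₂)} u (root∈bag l₁ m₁ r₁) (root∈bag l₂ m₂ r₂)

-- Alt b x: every vertex of x that is not a leaf has a left subtree, of odd size; b is the parity of the size of x.
data Alt : Bool → BinTree → Set where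
  alt-∅ : Alt false ∅
  alt-tip : ∀ m → Alt true (node ∅ m ∅)
  alt-node : ∀ {l m r b} → Alt true l → Alt b r → Alt b (node l m r)

oddSize : BinTree → Bool
oddSize ∅ = false
oddSize (node l m r) = not (oddSize l xor oddSize r)

Alt-oddSize : ∀ {b x} → Alt b x → oddSize x ≡ b
Alt-oddSize alt-∅ = refl
Alt-oddSize (alt-tip m) = refl
Alt-oddSize (alt-node {b = false} dL dR) rewrite Alt-oddSize dL | Alt-oddSize dR = refl
Alt-oddSize (alt-node {b = true} dL dR) rewrite Alt-oddSize dL | Alt-oddSize dR = refl

odd⇒IsNode : ∀ {x} → Alt true x → IsNode x
odd⇒IsNode (alt-tip m) = ∅ , m , ∅ , refl
odd⇒IsNode (alt-node {l = l} {m} {r} _ _) = l , m , r , refl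

odd-root∈bag : ∀ {x} → Alt true x → 0 < bag x (root x)
odd-root∈bag dx with odd⇒IsNode dx
... | l , m , r , refl = root∈bag l m r

leftmost-node : ∀ a m r → Alt true a → leftmost (node a m r) ≡ leftmost a
leftmost-node _ m r (alt-tip _) = refl
leftmost-node _ m r (alt-node _ _) = refl

Every<⇒root≮ : ∀ {μ x} → Alt true x → Every (μ <_) (bag x) → ¬ root x < μ
Every<⇒root≮ dx h lt = <-asym lt (h _ (odd-root∈bag dx))

-- Down-up words are exactly the inorder readings of Alt heaps

isOdd : ℕ → Bool
isOdd zero = false
isOdd (suc n) = not (isOdd n)

isOdd-+ : ∀ a c → isOdd (a + c) ≡ isOdd a xor isOdd c
isOdd-+ zero c = refl
isOdd-+ (suc a) c rewrite isOdd-+ a c with isOdd a | isOdd c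
... | true | true = refl
... | true | false = refl
... | false | true = refl
... | false | false = refl

Alt-isOdd : ∀ {b x} → Alt b x → isOdd (size x) ≡ b
Alt-isOdd alt-∅ = refl
Alt-isOdd (alt-tip m) = refl
Alt-isOdd (alt-node {l = l} {m} {r} {b} dL dR)
  rewrite size-node l m r | isOdd-+ (size l) (suc (size r)) | Alt-isOdd dL | Alt-isOdd dR with b
... | true = refl
... | false = refl

not≡true : ∀ {a} → not a ≡ true → a ≡ false
not≡true {false} _ = refl

not≡false : ∀ {a} → not a ≡ false → a ≡ true
not≡false {true} _ = refl

mutual
  down-split : ∀ α m β → Down (α ++ m ∷ β) → All (m <_) α → All (m <_) β →
    (α ≡ [] × β ≡ []) ⊎ (isOdd (length α) ≡ true × Down α × Down β)
  down-split [] m [] d ha hb = inj₁ (refl , refl)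
  down-split [] m (y ∷ β) (d∷ gt _) ha (py ∷ hb) = ⊥-elim (<-asym gt py)
  down-split (x ∷ []) m [] (d∷ gt _) ha hb = inj₂ (refl , d[ x ] , d[])
  down-split (x ∷ []) m (y ∷ β) (d∷ gt (u∷ lt dy)) ha hb = inj₂ (refl , d[ x ] , dy)
  down-split (x ∷ y ∷ α) m β (d∷ gt up) (px ∷ ha) hb with up-split (y ∷ α) m β up ha hb (λ ())
  ... | ev , uα , dβ = inj₂ (cong not ev , d∷ gt uα , dβ)

  up-split : ∀ α m β → Up (α ++ m ∷ β) → All (m <_) α → All (m <_) β → α ≢ [] →
    isOdd (length α) ≡ false × Up α × Down β
  up-split [] m β _ _ _ ne = ⊥-elim (ne refl)
  up-split (x ∷ []) m β (u∷ lt _) (px ∷ _) _ _ = ⊥-elim (<-asym lt px)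
  up-split (x ∷ y ∷ α) m β (u∷ lt dn') (px ∷ ha) hb _ with down-split (y ∷ α) m β dn' ha hb
  ... | inj₂ (od , dα , dβ) = cong not od , u∷ lt dα , dβ

mutual
  down-join : ∀ α m β → Down α → isOdd (length α) ≡ true → All (m <_) α → Down β → All (m <_) β → Down (α ++ m ∷ β)
  down-join (x ∷ []) m [] _ _ (px ∷ _) _ _ = d∷ px u[ m ]
  down-join (x ∷ []) m (y ∷ β) _ _ (px ∷ _) dβ (py ∷ _) = d∷ px (u∷ py dβ)
  down-join (x ∷ y ∷ α) m β (d∷ gt uα) od (px ∷ ha) dβ hb = d∷ gt (up-join (y ∷ α) m β uα (not≡true od) ha dβ hb)

  up-join : ∀ α m β → Up α → isOdd (length α) ≡ false → All (m <_) α → Down β → All (m <_) β → Up (α ++ m ∷ β)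
  up-join [] m [] _ _ _ dβ hb = u[ m ]
  up-join [] m (y ∷ β) _ _ _ dβ (py ∷ hb) = u∷ py dβ
  up-join (x ∷ y ∷ α) m β (u∷ lt dα) ev (px ∷ ha) dβ hb = u∷ lt (down-join (y ∷ α) m β dα (not≡false ev) ha dβ hb)

Down-inorder : ∀ {b x} → Alt b x → Heap x → Down (inorder x)
Down-inorder alt-∅ _ = d[]
Down-inorder (alt-tip m) _ = d[ m ]
Down-inorder (alt-node {l = l} {m} {r} dL dR) (hl , hr , hpl , hpr) =
  down-join (inorder l) m (inorder r) (Down-inorder dL hpl) (Alt-isOdd dL) (Every⇒All (inorder l) hl)
            (Down-inorder dR hpr) (Every⇒All (inorder r) hr)

inorder-head : ∀ {b x} → Alt b x → IsNode x → Σ (List ℕ) λ rest → inorder x ≡ leftmost x ∷ rest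
inorder-head alt-∅ (_ , _ , _ , ())
inorder-head (alt-tip m) _ = [] , refl
inorder-head (alt-node {l = l} {m} {r} dL dR) _ with inorder-head dL (odd⇒IsNode dL)
... | rest , e = rest ++ m ∷ inorder r ,
  trans (cong (_++ m ∷ inorder r) e) (cong (_∷ (rest ++ m ∷ inorder r)) (sym (leftmost-node l m r dL)))

++-∷-cancel : ∀ {m : ℕ} a b c d → m ∉ a → m ∉ c → a ++ m ∷ b ≡ c ++ m ∷ d → a ≡ c × b ≡ d
++-∷-cancel [] b [] d _ _ refl = refl , refl
++-∷-cancel [] b (x ∷ c) d _ m∉c refl = ⊥-elim (m∉c (here refl))
++-∷-cancel (x ∷ a) b [] d m∉a _ refl = ⊥-elim (m∉a (here refl))
++-∷-cancel (x ∷ a) b (y ∷ c) d m∉a m∉c e with ∷-injective e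
... | refl , e′ with ++-∷-cancel a b c d (λ p → m∉a (there p)) (λ p → m∉c (there p)) e′
... | refl , refl = refl , refl

[]≢++∷ : ∀ (xs : List ℕ) {m ys} → [] ≢ xs ++ m ∷ ys
[]≢++∷ [] ()
[]≢++∷ (_ ∷ _) ()

inorder-injective : ∀ x y → Heap x → Heap y → inorder x ≡ inorder y → x ≡ y
inorder-injective ∅ ∅ _ _ _ = refl
inorder-injective ∅ (node l m r) _ _ e = ⊥-elim ([]≢++∷ (inorder l) e)
inorder-injective (node l m r) ∅ _ _ e = ⊥-elim ([]≢++∷ (inorder l) (sym e))
inorder-injective (node l m r) (node l′ m′ r′) hx@(hl , _ , hpl , hpr) hy@(hl′ , _ , hpl′ , hpr′) e with m ≟ m′
... | yes refl with ++-∷-cancel (inorder l) (inorder r) (inorder l′) (inorder r′) (Every<⇒∉ (inorder l) hl) (Every<⇒∉ (inorder l′) hl′) e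
...   | el , er = cong₂ (λ p q → node p m q) (inorder-injective l l′ hpl hpl′ el) (inorder-injective r r′ hpr hpr′ er)
inorder-injective (node l m r) (node l′ m′ r′) hx hy e | no m≢m′ =
  ⊥-elim (m≢m′ (≤-antisym (Heap-root≤ (node l m r) hx m′ (subst (λ z → 0 < count z m′) (sym e) (root∈bag l′ m′ r′)))
                  (Heap-root≤ (node l′ m′ r′) hy m (subst (λ z → 0 < count z m) e (root∈bag l m r)))))

minimum : ∀ x xs → Σ ℕ λ m → m ∈ (x ∷ xs) × All (m ≤_) (x ∷ xs)
minimum x [] = x , here refl , ≤-refl ∷ []
minimum x (y ∷ ys) with minimum y ys
... | m , mem , al with x ≤? m
... | yes x≤m = x , here refl , ≤-refl ∷ All.map (≤-trans x≤m) al
... | no x≰m = m , there mem , <⇒≤ (≰⇒> x≰m) ∷ al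

record TreeOf (w : List ℕ) : Set where
  constructor heap-of
  field
    heap : BinTree
    reads : inorder heap ≡ w
    {parity} : Bool
    alt : Alt parity heap
    ordered : Heap heap

length-split : ∀ α (m : ℕ) β n → length (α ++ m ∷ β) ≤ suc n → length α ≤ n × length β ≤ n
length-split α m β n le with subst (_≤ suc n) (trans (length-++ α) (+-suc (length α) (length β))) le
... | s≤s k = ≤-trans (m≤m+n _ _) k , ≤-trans (m≤n+m _ _) k

≤∧∉⇒< : ∀ {m} xs → All (m ≤_) xs → count xs m ≡ 0 → All (m <_) xs
≤∧∉⇒< [] _ _ = []
≤∧∉⇒< {m} (x ∷ xs) (m≤x ∷ ps) c with m ≟ x
... | no m≢x = ≤∧≢⇒< m≤x m≢x ∷ ≤∧∉⇒< xs ps c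

split-at-min : ∀ α m β → Distinct (count (α ++ m ∷ β)) → All (m ≤_) (α ++ m ∷ β) → All (m <_) α × All (m <_) β
split-at-min α m β u al = ≤∧∉⇒< α (AllP.++⁻ˡ α al) (m+n≡0⇒m≡0 _ others≡0) , ≤∧∉⇒< β (All.tail (AllP.++⁻ʳ α al)) (m+n≡0⇒n≡0 _ others≡0)
  where
  others≡0 : count α m + count β m ≡ 0
  others≡0 = n≤0⇒n≡0 (≤-pred (subst (_≤ 1) (trans (count-++ α (m ∷ β) m) (trans (cong (λ k → count α m + (k + count β m)) (δ-refl m)) (+-suc _ _))) (u m)))

mutual
  treeOf : ∀ n w → length w ≤ n → Down w → Distinct (count w) → TreeOf w
  treeOf n [] _ _ _ = heap-of ∅ refl alt-∅ tt
  treeOf (suc n) (x ∷ xs) le dw u with minimum x xs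
  ... | m , mem , al with ∈-∃++ mem
  ... | α , β , e = subst TreeOf (sym e) (treeOf-at-min n α m β (subst (λ z → length z ≤ suc n) e le) (subst Down e dw)
                                                          (subst (λ z → Distinct (count z)) e u) (subst (All (m ≤_)) e al))

  treeOf-at-min : ∀ n α m β → length (α ++ m ∷ β) ≤ suc n → Down (α ++ m ∷ β) → Distinct (count (α ++ m ∷ β)) →
    All (m ≤_) (α ++ m ∷ β) → TreeOf (α ++ m ∷ β)
  treeOf-at-min n α m β le dw u al with split-at-min α m β u al
  ... | sα , sβ with down-split α m β dw sα sβ
  ... | inj₁ (refl , refl) = heap-of (node ∅ m ∅) refl (alt-tip m) (Every-∅ , Every-∅ , tt , tt)
  ... | inj₂ (od , dα , dβ) with treeOf n α (proj₁ (length-split α m β n le)) dα (Distinct-++ˡ α (m ∷ β) u)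
                               | treeOf n β (proj₂ (length-split α m β n le)) dβ (Distinct-mono (Distinct-++ʳ α (m ∷ β) u) (λ a → m≤n+m (count β a) (δ a m)))
  ... | heap-of xα refl dxα hα | heap-of xβ refl dxβ hβ =
    heap-of (node xα m xβ) refl (alt-node (subst (λ b → Alt b xα) (trans (sym (Alt-isOdd dxα)) od) dxα) dxβ)
            (All⇒Every (inorder xα) sα , All⇒Every (inorder xβ) sβ , hα , hβ)

-- Splitting and merging pairs of heaps

-- merge walks down the right spines of two odd heaps in increasing order; the
-- tip that ends the spine with the smaller label adopts the rest of the other heap.
merge : BinTree → BinTree → BinTree × BinTree
merge-by : (x y : BinTree) → Dec (root x < root y) → BinTree × BinTree
merge< : BinTree → BinTree → BinTree × BinTree
merge≮ : BinTree → BinTree → BinTree × BinTree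
merge x y = merge-by x y (root x <? root y)
merge-by x y (yes _) = merge< x y
merge-by x y (no _) = merge≮ x y
merge< (node ∅ m r) y = node y m ∅ , ∅
merge< (node (node a b c) m r) y = node (node a b c) m (proj₁ (merge r y)) , proj₂ (merge r y)
merge< ∅ y = ∅ , ∅
merge≮ x (node ∅ m r) = ∅ , node x m ∅
merge≮ x (node (node a b c) m r) = proj₁ (merge x r) , node (node a b c) m (proj₂ (merge x r))
merge≮ x ∅ = ∅ , ∅

unmerge : BinTree → BinTree → BinTree × BinTree
unmerge-by : (e d : BinTree) → Dec (root e < root d) → BinTree × BinTree
unmerge< : BinTree → BinTree → BinTree × BinTree
unmerge≮ : BinTree → BinTree → BinTree × BinTree
unmerge ∅ ∅ = ∅ , ∅
unmerge ∅ (node d₁ ν ∅) = d₁ , node ∅ ν ∅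
unmerge ∅ (node d₁ ν (node a b c)) = proj₁ (unmerge ∅ (node a b c)) , node d₁ ν (proj₂ (unmerge ∅ (node a b c)))
unmerge e@(node _ _ _) d@(node _ _ _) = unmerge-by e d (root e <? root d)
unmerge (node e₁ ν ∅) ∅ = node ∅ ν ∅ , e₁
unmerge (node e₁ ν (node a b c)) ∅ = node e₁ ν (proj₁ (unmerge (node a b c) ∅)) , proj₂ (unmerge (node a b c) ∅)
unmerge-by e d (yes _) = unmerge< e d
unmerge-by e d (no _) = unmerge≮ e d
unmerge< (node e₁ ν e₂) d = node e₁ ν (proj₁ (unmerge e₂ d)) , proj₂ (unmerge e₂ d)
unmerge< ∅ d = ∅ , ∅
unmerge≮ e (node d₁ μ d₂) = proj₁ (unmerge e d₂) , node d₁ μ (proj₂ (unmerge e d₂))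
unmerge≮ e ∅ = ∅ , ∅

bag₂ : BinTree × BinTree → Bag
bag₂ (e , d) = bag e ⊕ bag d

HeapPair : Bool → BinTree × BinTree → Set
HeapPair b (e , d) = Alt b e × Alt b d × Heap e × Heap d

data NotBoth∅ : BinTree × BinTree → Set where
  left-node : ∀ {a b c d} → NotBoth∅ (node a b c , d)
  right-node : ∀ {a b c e} → NotBoth∅ (e , node a b c)

merge-bag : ∀ x y → Alt true x → Alt true y → bag₂ (merge x y) ≗ bag₂ (x , y)
merge-bag (node l₁ m₁ r₁) (node l₂ m₂ r₂) dx dy with m₁ <? m₂
merge-bag (node ∅ m₁ ∅) y (alt-tip m₁) dy | yes _ = bag-swallowˡ y m₁
merge-bag (node ∅ m₁ r₁) y (alt-node () _) dy | yes _
merge-bag (node (node a b c) m₁ r₁) y (alt-node _ dr) dy | yes _ =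
  bag-replaceʳ (node a b c) m₁ r₁ (proj₁ (merge r₁ y)) (bag (proj₂ (merge r₁ y))) (bag y) (merge-bag r₁ y dr dy)
merge-bag x (node ∅ m₂ ∅) dx (alt-tip m₂) | no _ = bag-swallowʳ x m₂
merge-bag x (node ∅ m₂ r₂) dx (alt-node () _) | no _
merge-bag x (node (node a b c) m₂ r₂) dx (alt-node _ dr) | no _ =
  bag-replaceʳ′ (node a b c) m₂ r₂ (proj₂ (merge x r₂)) (bag (proj₁ (merge x r₂))) (bag x) (merge-bag x r₂ dx dr)

unmerge-bag : ∀ e d → bag₂ (unmerge e d) ≗ bag₂ (e , d)
unmerge-bag ∅ ∅ a = refl
unmerge-bag ∅ (node d₁ ν ∅) a = sym (bag-swallowʳ d₁ ν a)
unmerge-bag ∅ (node d₁ ν d₂@(node _ _ _)) =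
  bag-replaceʳ′ d₁ ν d₂ (proj₂ (unmerge ∅ d₂)) (bag (proj₁ (unmerge ∅ d₂))) (bag ∅) (unmerge-bag ∅ d₂)
unmerge-bag (node e₁ ν e₂) (node d₁ μ d₂) with ν <? μ | unmerge-bag e₂ (node d₁ μ d₂) | unmerge-bag (node e₁ ν e₂) d₂
... | yes _ | ih | _ = bag-replaceʳ e₁ ν e₂ (proj₁ (unmerge e₂ (node d₁ μ d₂))) (bag (proj₂ (unmerge e₂ (node d₁ μ d₂)))) (bag (node d₁ μ d₂)) ih
... | no _ | _ | ih = bag-replaceʳ′ d₁ μ d₂ (proj₂ (unmerge (node e₁ ν e₂) d₂)) (bag (proj₁ (unmerge (node e₁ ν e₂) d₂))) (bag (node e₁ ν e₂)) ih
unmerge-bag (node e₁ ν ∅) ∅ a = sym (bag-swallowˡ e₁ ν a)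
unmerge-bag (node e₁ ν e₂@(node _ _ _)) ∅ =
  bag-replaceʳ e₁ ν e₂ (proj₁ (unmerge e₂ ∅)) (bag (proj₂ (unmerge e₂ ∅))) (bag ∅) (unmerge-bag e₂ ∅)

merge-ok : ∀ x y → Alt true x → Alt true y → Heap x → Heap y → Distinct (bag₂ (x , y)) →
  HeapPair false (merge x y) × NotBoth∅ (merge x y)
merge-ok (node l₁ m₁ r₁) (node l₂ m₂ r₂) dx dy hx hy u with m₁ <? m₂
merge-ok (node ∅ m₁ ∅) y (alt-tip m₁) dy hx hy u | yes m₁<m₂ =
  (alt-node dy alt-∅ , alt-∅ , (Heap-root< y hy m₁<m₂ , Every-∅ , hy , tt) , tt) , left-node
merge-ok (node ∅ m₁ r₁) y (alt-node () _) dy hx hy u | yes _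
merge-ok (node (node a b c) m₁ r₁) y (alt-node dl dr) dy (hl , hr , hpl , hpr) hy u | yes m₁<m₂
  with merge-ok r₁ y dr dy hpr hy (Distinct-⊕-mono u (bag-right≤ (node a b c) m₁ r₁) (λ _ → ≤-refl))
... | (de , dd , he , hd) , _ = (alt-node dl de , dd , (hl , above , hpl , he) , hd) , left-node
  where above : Every (m₁ <_) (bag (proj₁ (merge r₁ y)))
        above = Every-⊕ˡ {g = bag (proj₂ (merge r₁ y))} (Every-≗ (merge-bag r₁ y dr dy) (Every-⊕ hr (Heap-root< y hy m₁<m₂)))
merge-ok x@(node l₁ m₁ r₁) (node ∅ m₂ ∅) dx (alt-tip m₂) hx hy u | no m₁≮m₂ =
  (alt-∅ , alt-node dx alt-∅ , tt , (Heap-root< x hx m₂<m₁ , Every-∅ , hx , tt)) , right-node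
  where m₂<m₁ = ≮∧≢⇒> m₁≮m₂ (distinct-roots l₁ m₁ r₁ ∅ m₂ ∅ u)
merge-ok x (node ∅ m₂ r₂) dx (alt-node () _) hx hy u | no _
merge-ok x@(node l₁ m₁ r₁) (node (node a b c) m₂ r₂) dx (alt-node dl dr) hx (hl , hr , hpl , hpr) u | no m₁≮m₂
  with merge-ok x r₂ dx dr hx hpr (Distinct-⊕-mono u (λ _ → ≤-refl) (bag-right≤ (node a b c) m₂ r₂))
... | (de , dd , he , hd) , _ = (de , alt-node dl dd , he , (hl , above , hpl , hd)) , right-node
  where m₂<m₁ = ≮∧≢⇒> m₁≮m₂ (distinct-roots l₁ m₁ r₁ (node a b c) m₂ r₂ u)
        above : Every (m₂ <_) (bag (proj₂ (merge x r₂)))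
        above = Every-⊕ʳ {f = bag (proj₁ (merge x r₂))} (Every-≗ (merge-bag x r₂ dx dr) (Every-⊕ (Heap-root< x hx m₂<m₁) hr))

unmerge-merge : ∀ x y → Alt true x → Alt true y → Heap x → Heap y → Distinct (bag₂ (x , y)) →
  unmerge (proj₁ (merge x y)) (proj₂ (merge x y)) ≡ (x , y)
unmerge-merge (node l₁ m₁ r₁) (node l₂ m₂ r₂) dx dy hx hy u with m₁ <? m₂
unmerge-merge (node ∅ m₁ ∅) y (alt-tip m₁) dy hx hy u | yes _ = refl
unmerge-merge (node ∅ m₁ r₁) y (alt-node () _) dy hx hy u | yes _
unmerge-merge (node (node a b c) m₁ r₁) y (alt-node dl dr) dy (hl , hr , hpl , hpr) hy u | yes m₁<m₂
  with merge r₁ y | merge-bag r₁ y dr dy | merge-ok r₁ y dr dy hpr hy u′ | unmerge-merge r₁ y dr dy hpr hy u′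
  where u′ = Distinct-⊕-mono u (bag-right≤ (node a b c) m₁ r₁) (λ _ → ≤-refl)
... | node _ _ _ , ∅ | _ | _ | ih rewrite ih = refl
... | ∅ , ∅ | _ | _ , () | _
... | e′ , node d₁ μ d₂ | same | _ | ih with m₁ <? μ
...   | yes _ rewrite ih = refl
...   | no m₁≮μ = ⊥-elim (m₁≮μ (Every-⊕ʳ {f = bag e′} (Every-≗ same (Every-⊕ hr (Heap-root< y hy m₁<m₂))) μ (root∈bag d₁ μ d₂)))
unmerge-merge (node l₁ m₁ r₁) (node ∅ m₂ ∅) dx (alt-tip m₂) hx hy u | no _ = refl
unmerge-merge x (node ∅ m₂ r₂) dx (alt-node () _) hx hy u | no _
unmerge-merge x@(node l₁ m₁ r₁) (node (node a b c) m₂ r₂) dx (alt-node dl dr) hx (hl , hr , hpl , hpr) u | no m₁≮m₂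
  with merge x r₂ | merge-bag x r₂ dx dr | merge-ok x r₂ dx dr hx hpr u′ | unmerge-merge x r₂ dx dr hx hpr u′
  where u′ = Distinct-⊕-mono u (λ _ → ≤-refl) (bag-right≤ (node a b c) m₂ r₂)
... | ∅ , node _ _ _ | _ | _ | ih rewrite ih = refl
... | ∅ , ∅ | _ | _ , () | _
... | node e₁ μ e₂ , d′ | same | _ | ih with μ <? m₂
...   | no _ rewrite ih = refl
...   | yes μ<m₂ = ⊥-elim (<-asym μ<m₂ (Every-⊕ˡ {g = bag d′} (Every-≗ same (Every-⊕ (Heap-root< x hx m₂<m₁) hr)) μ (root∈bag e₁ μ e₂)))
  where m₂<m₁ = ≮∧≢⇒> m₁≮m₂ (distinct-roots l₁ m₁ r₁ (node a b c) m₂ r₂ u)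

unmerge-ok : ∀ e d → Alt false e → Alt false d → Heap e → Heap d → Distinct (bag₂ (e , d)) → NotBoth∅ (e , d) →
  HeapPair true (unmerge e d) × merge (proj₁ (unmerge e d)) (proj₂ (unmerge e d)) ≡ (e , d)
unmerge-ok ∅ ∅ _ _ _ _ _ ()
unmerge-ok ∅ (node ∅ ν _) _ (alt-node () _) _ _ _ _
unmerge-ok (node ∅ ν _) _ (alt-node () _) _ _ _ _ _
unmerge-ok (node (node _ _ _) ν _) (node ∅ μ _) _ (alt-node () _) _ _ _ _
unmerge-ok ∅ (node d₁@(node p q w) ν ∅) _ (alt-node dd₁ alt-∅) _ (hl , _ , hpl , _) _ _ =
  (dd₁ , alt-tip ν , hpl , (Every-∅ , Every-∅ , tt , tt)) , adopt
  where adopt : merge d₁ (node ∅ ν ∅) ≡ (∅ , node d₁ ν ∅)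
        adopt with q <? ν
        ... | no _ = refl
        ... | yes q<ν = ⊥-elim (<-asym q<ν (hl q (root∈bag p q w)))
unmerge-ok ∅ (node d₁@(node _ _ _) ν d₂@(node _ _ _)) de (alt-node dd₁ dd₂) he (hl , hr , hpl , hpr) u _
  with unmerge ∅ d₂ | unmerge-bag ∅ d₂ | unmerge-ok ∅ d₂ de dd₂ he hpr (Distinct-⊕-mono u (λ _ → ≤-refl) (bag-right≤ d₁ ν d₂)) right-node
... | β₁ , β₂ | same | (dβ₁ , dβ₂ , hβ₁ , hβ₂) , ih =
  (dβ₁ , alt-node dd₁ dβ₂ , hβ₁ , (hl , Every-⊕ʳ {f = bag β₁} above , hpl , hβ₂)) , remerge
  where above : Every (ν <_) (bag β₁ ⊕ bag β₂)
        above = Every-≗ same (Every-⊕ {f = bag ∅} Every-∅ hr)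
        remerge : merge β₁ (node d₁ ν β₂) ≡ (∅ , node d₁ ν d₂)
        remerge with root β₁ <? ν
        ... | yes β₁<ν = ⊥-elim (<-asym β₁<ν (Every-⊕ˡ {g = bag β₂} above (root β₁) (odd-root∈bag dβ₁)))
        ... | no _ rewrite ih = refl
unmerge-ok (node e₁@(node p q w) ν ∅) ∅ (alt-node de₁ alt-∅) _ (hl , _ , hpl , _) _ _ _ =
  (alt-tip ν , de₁ , (Every-∅ , Every-∅ , tt , tt) , hpl) , adopt
  where adopt : merge (node ∅ ν ∅) e₁ ≡ (node e₁ ν ∅ , ∅)
        adopt with ν <? q
        ... | yes _ = refl
        ... | no ν≮q = ⊥-elim (ν≮q (hl q (root∈bag p q w)))
unmerge-ok (node e₁@(node _ _ _) ν e₂@(node _ _ _)) ∅ (alt-node de₁ de₂) dd (hl , hr , hpl , hpr) hd u _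
  with unmerge e₂ ∅ | unmerge-bag e₂ ∅ | unmerge-ok e₂ ∅ de₂ dd hpr hd (Distinct-⊕-mono u (bag-right≤ e₁ ν e₂) (λ _ → ≤-refl)) left-node
... | β₁ , β₂ | same | (dβ₁ , dβ₂ , hβ₁ , hβ₂) , ih =
  (alt-node de₁ dβ₁ , dβ₂ , (hl , Every-⊕ˡ {g = bag β₂} above , hpl , hβ₁) , hβ₂) , remerge
  where above : Every (ν <_) (bag β₁ ⊕ bag β₂)
        above = Every-≗ same (Every-⊕ {g = bag ∅} hr Every-∅)
        remerge : merge (node e₁ ν β₁) β₂ ≡ (node e₁ ν e₂ , ∅)
        remerge with ν <? root β₂
        ... | no ν≮β₂ = ⊥-elim (ν≮β₂ (Every-⊕ʳ {f = bag β₁} above (root β₂) (odd-root∈bag dβ₂)))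
        ... | yes _ rewrite ih = refl
unmerge-ok e@(node e₁@(node _ _ _) ν e₂) d@(node d₁@(node _ _ _) μ d₂) de@(alt-node de₁ de₂) dd@(alt-node dd₁ dd₂)
           he@(hl , hr , hpl , hpr) hd@(hl′ , hr′ , hpl′ , hpr′) u _
  with ν <? μ | unmerge-bag e₂ d | unmerge-ok e₂ d de₂ dd hpr hd (Distinct-⊕-mono u (bag-right≤ e₁ ν e₂) (λ _ → ≤-refl)) right-node
              | unmerge-bag e d₂ | unmerge-ok e d₂ de dd₂ he hpr′ (Distinct-⊕-mono u (λ _ → ≤-refl) (bag-right≤ d₁ μ d₂)) left-node
... | yes ν<μ | same | (dβ₁ , dβ₂ , hβ₁ , hβ₂) , ih | _ | _ =
  (alt-node de₁ dβ₁ , dβ₂ , (hl , Every-⊕ˡ {g = bag β₂} above , hpl , hβ₁) , hβ₂) , remerge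
  where β₁ = proj₁ (unmerge e₂ d)
        β₂ = proj₂ (unmerge e₂ d)
        above : Every (ν <_) (bag β₁ ⊕ bag β₂)
        above = Every-≗ same (Every-⊕ hr (Heap-root< d hd ν<μ))
        remerge : merge (node e₁ ν β₁) β₂ ≡ (e , d)
        remerge with ν <? root β₂
        ... | no ν≮β₂ = ⊥-elim (ν≮β₂ (Every-⊕ʳ {f = bag β₁} above (root β₂) (odd-root∈bag dβ₂)))
        ... | yes _ rewrite ih = refl
... | no ν≮μ | _ | _ | same | (dβ₁ , dβ₂ , hβ₁ , hβ₂) , ih =
  (dβ₁ , alt-node dd₁ dβ₂ , hβ₁ , (hl′ , Every-⊕ʳ {f = bag β₁} above , hpl′ , hβ₂)) , remerge
  where β₁ = proj₁ (unmerge e d₂)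
        β₂ = proj₂ (unmerge e d₂)
        μ<ν = ≮∧≢⇒> ν≮μ (distinct-roots e₁ ν e₂ d₁ μ d₂ u)
        above : Every (μ <_) (bag β₁ ⊕ bag β₂)
        above = Every-≗ same (Every-⊕ (Heap-root< e he μ<ν) hr′)
        remerge : merge β₁ (node d₁ μ β₂) ≡ (e , d)
        remerge with root β₁ <? μ
        ... | yes β₁<μ = ⊥-elim (<-asym β₁<μ (Every-⊕ˡ {g = bag β₂} above (root β₁) (odd-root∈bag dβ₁)))
        ... | no _ rewrite ih = refl

-- Increasing trees with at most two children per vertex

data Tree : Set where
  tip : ℕ → Tree
  one : ℕ → Tree → Tree
  two : ℕ → Tree → Tree → Tree

top : Tree → ℕ
top (tip m) = m
top (one m _) = m
top (two m _ _) = m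

vertices : Tree → List ℕ
vertices (tip m) = m ∷ []
vertices (one m t) = m ∷ vertices t
vertices (two m s t) = m ∷ vertices s ++ vertices t

minLeaf : Tree → ℕ
minLeaf (tip m) = m
minLeaf (one m t) = minLeaf t
minLeaf (two m s t) = minLeaf s

order : Tree → ℕ
order t = length (vertices t)

order-two : ∀ m s t → order (two m s t) ≡ suc (order s + order t)
order-two m s t = cong suc (length-++ (vertices s))

bagT : Tree → Bag
bagT t = count (vertices t)

bagT-two : ∀ m s t → bagT (two m s t) ≗ ⟦ m ⟧ ⊕ bagT s ⊕ bagT t
bagT-two m s t a = cong (δ a m +_) (count-++ (vertices s) (vertices t) a)

Increasing : Tree → Set
Increasing (tip m) = ⊤
Increasing (one m t) = Every (m <_) (bagT t) × Increasing t
Increasing (two m s t) = Every (m <_) (bagT s) × Every (m <_) (bagT t) × top s < top t × Increasing s × Increasing t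

Increasing-top≤ : ∀ t → Increasing t → Every (top t ≤_) (bagT t)
Increasing-top≤ (tip m) _ = Every-δ+ {f = λ _ → 0} ≤-refl (λ _ ())
Increasing-top≤ (one m t) (h , _) = Every-δ+ {f = bagT t} ≤-refl (Every-mono <⇒≤ h)
Increasing-top≤ (two m s t) (hs , ht , _) =
  Every-≗ (bagT-two m s t) (Every-δ+ {f = bagT s ⊕ bagT t} ≤-refl (Every-mono <⇒≤ (Every-⊕ hs ht)))

Distinct-one : ∀ m t → Distinct (bagT (one m t)) → Distinct (bagT t)
Distinct-one m t u = Distinct-mono u (λ a → m≤n+m (bagT t a) (δ a m))

Distinct-two : ∀ m s t → Distinct (bagT (two m s t)) → Distinct (bagT s ⊕ bagT t)
Distinct-two m s t u = Distinct-mono u (λ a → ≤-trans (m≤n+m _ (δ a m)) (≤-reflexive (sym (bagT-two m s t a))))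

-- Encoding a tree as an Alt heap

-- A vertex m with subtrees encoded by a and b: if a has odd size it becomes the left
-- subtree of m; otherwise m takes the place of the root μ of a, which moves down.
sink : ℕ → BinTree → BinTree → BinTree
sink μ a b = node (proj₁ (unmerge a b)) μ (proj₂ (unmerge a b))

joinEven : ℕ → BinTree → BinTree → BinTree
joinEven m ∅ b = ∅
joinEven m (node α μ a) b with oddSize b
... | true = node α m (node b μ a)
... | false = node α m (sink μ a b)

join : ℕ → BinTree → BinTree → BinTree
join m a b with oddSize a
... | true = node a m b
... | false = joinEven m a b

encode : Tree → BinTree
encode (tip m) = node ∅ m ∅
encode (one m t) = join m (encode t) ∅
encode (two m s t) = join m (encode s) (encode t)

join-odd : ∀ m a b → Alt true a → join m a b ≡ node a m b
join-odd m a b da rewrite Alt-oddSize da = refl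

join-even : ∀ m α μ a b → Alt true α → Alt false a → join m (node α μ a) b ≡ joinEven m (node α μ a) b
join-even m α μ a b dα da rewrite Alt-oddSize dα | Alt-oddSize da = refl

joinEven-odd : ∀ m α μ a b → Alt true b → joinEven m (node α μ a) b ≡ node α m (node b μ a)
joinEven-odd m α μ a b db rewrite Alt-oddSize db = refl

joinEven-even : ∀ m α μ a b → Alt false b → joinEven m (node α μ a) b ≡ node α m (sink μ a b)
joinEven-even m α μ a b db rewrite Alt-oddSize db = refl

bag-sink : ∀ μ a b → bag (sink μ a b) ≗ ⟦ μ ⟧ ⊕ bag a ⊕ bag b
bag-sink μ a b x = trans (bag-node β₁ μ β₂ x) (trans (exchange (bag β₁ x) (δ x μ) (bag β₂ x)) (cong (δ x μ +_) (unmerge-bag a b x)))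
  where β₁ = proj₁ (unmerge a b)
        β₂ = proj₂ (unmerge a b)
        exchange : ∀ p q r → p + (q + r) ≡ q + (p + r)
        exchange = solve-∀

sink-ok-NotBoth∅ : ∀ μ a b → Alt false a → Alt false b → Heap a → Heap b → Every (μ <_) (bag a ⊕ bag b) →
  Distinct (bag a ⊕ bag b) → NotBoth∅ (a , b) → Alt true (sink μ a b) × Heap (sink μ a b)
sink-ok-NotBoth∅ μ a b da db ha hb above u nb with unmerge-ok a b da db ha hb u nb
... | (dβ₁ , dβ₂ , hβ₁ , hβ₂) , _ = alt-node dβ₁ dβ₂ , (Every-⊕ˡ above′ , Every-⊕ʳ above′ , hβ₁ , hβ₂)
  where above′ = Every-≗ (unmerge-bag a b) above

sink-ok : ∀ μ a b → Alt false a → Alt false b → Heap a → Heap b → Every (μ <_) (bag a ⊕ bag b) → Distinct (bag a ⊕ bag b) →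
  Alt true (sink μ a b) × Heap (sink μ a b)
sink-ok μ ∅ ∅ _ _ _ _ _ _ = alt-tip μ , (Every-∅ , Every-∅ , tt , tt)
sink-ok μ a@(node _ _ _) b da db ha hb above u = sink-ok-NotBoth∅ μ a b da db ha hb above u left-node
sink-ok μ ∅ b@(node _ _ _) da db ha hb above u = sink-ok-NotBoth∅ μ ∅ b da db ha hb above u right-node

join-node : ∀ m a b → IsNode a → Σ BinTree λ l → Σ BinTree λ r → join m a b ≡ node l m r
join-node m .(node α μ a) b (α , μ , a , refl) with oddSize (node α μ a)
... | true = node α μ a , b , refl
... | false with oddSize b
...   | true = α , node b μ a , refl
...   | false = α , _ , refl

bag-join : ∀ m a b → IsNode a → bag (join m a b) ≗ ⟦ m ⟧ ⊕ bag a ⊕ bag b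
bag-join m .(node α μ a) b (α , μ , a , refl) x with oddSize (node α μ a)
... | true = trans (bag-node (node α μ a) m b x) (exchange (bag (node α μ a) x) (δ x m) (bag b x))
  where exchange : ∀ p q r → p + (q + r) ≡ q + (p + r)
        exchange = solve-∀
... | false with oddSize b
...   | true = begin
  bag (node α m (node b μ a)) x                           ≡⟨ bag-node α m (node b μ a) x ⟩
  bag α x + (δ x m + bag (node b μ a) x)                  ≡⟨ cong (λ k → bag α x + (δ x m + k)) (bag-node b μ a x) ⟩
  bag α x + (δ x m + (bag b x + (δ x μ + bag a x)))       ≡⟨ regroup (bag α x) (δ x m) (bag b x) (δ x μ) (bag a x) ⟩
  δ x m + ((bag α x + (δ x μ + bag a x)) + bag b x)       ≡⟨ cong (λ k → δ x m + (k + bag b x)) (bag-node α μ a x) ⟨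
  δ x m + (bag (node α μ a) x + bag b x)                  ∎
  where open ≡-Reasoning
        regroup : ∀ p q r s t → p + (q + (r + (s + t))) ≡ q + ((p + (s + t)) + r)
        regroup = solve-∀
...   | false = begin
  bag (node α m (sink μ a b)) x                           ≡⟨ bag-node α m (sink μ a b) x ⟩
  bag α x + (δ x m + bag (sink μ a b) x)                  ≡⟨ cong (λ k → bag α x + (δ x m + k)) (bag-sink μ a b x) ⟩
  bag α x + (δ x m + (δ x μ + (bag a x + bag b x)))       ≡⟨ regroup (bag α x) (δ x m) (δ x μ) (bag a x) (bag b x) ⟩
  δ x m + ((bag α x + (δ x μ + bag a x)) + bag b x)       ≡⟨ cong (λ k → δ x m + (k + bag b x)) (bag-node α μ a x) ⟨
  δ x m + (bag (node α μ a) x + bag b x)                  ∎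
  where open ≡-Reasoning
        regroup : ∀ p q s r t → p + (q + (s + (r + t))) ≡ q + ((p + (s + r)) + t)
        regroup = solve-∀

encode-node : ∀ t → Σ BinTree λ l → Σ BinTree λ r → encode t ≡ node l (top t) r
encode-node (tip m) = ∅ , ∅ , refl
encode-node (one m t) with encode-node t
... | l , r , e = join-node m (encode t) ∅ (l , top t , r , e)
encode-node (two m s t) with encode-node s
... | l , r , e = join-node m (encode s) (encode t) (l , top s , r , e)

encode-IsNode : ∀ t → IsNode (encode t)
encode-IsNode t with encode-node t
... | l , r , e = l , top t , r , e

encode-root : ∀ t → root (encode t) ≡ top t
encode-root t with encode-node t
... | l , r , e = cong root e

bag-encode : ∀ t → bag (encode t) ≗ bagT t
bag-encode (tip m) a = refl
bag-encode (one m t) a = begin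
  bag (join m (encode t) ∅) a          ≡⟨ bag-join m (encode t) ∅ (encode-IsNode t) a ⟩
  δ a m + (bag (encode t) a + 0)      ≡⟨ cong (λ k → δ a m + k) (+-identityʳ _) ⟩
  δ a m + bag (encode t) a            ≡⟨ cong (δ a m +_) (bag-encode t a) ⟩
  δ a m + bagT t a                    ∎
  where open ≡-Reasoning
bag-encode (two m s t) a = begin
  bag (join m (encode s) (encode t)) a          ≡⟨ bag-join m (encode s) (encode t) (encode-IsNode s) a ⟩
  δ a m + (bag (encode s) a + bag (encode t) a) ≡⟨ cong (δ a m +_) (cong₂ _+_ (bag-encode s a) (bag-encode t a)) ⟩
  δ a m + (bagT s a + bagT t a)                 ≡⟨ bagT-two m s t a ⟨
  bagT (two m s t) a                            ∎
  where open ≡-Reasoning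

size-join : ∀ m a b → IsNode a → size (join m a b) ≡ suc (size a + size b)
size-join m a b na =
  trans (count≗⇒length≡ (inorder (join m a b)) (m ∷ inorder a ++ inorder b) same) (cong suc (length-++ (inorder a)))
  where same : count (inorder (join m a b)) ≗ count (m ∷ inorder a ++ inorder b)
        same x = trans (bag-join m a b na x) (cong (δ x m +_) (sym (count-++ (inorder a) (inorder b) x)))

join-above : ∀ m a b → IsNode a → Heap (join m a b) → Distinct (bag (join m a b)) → Every (m <_) (bag a ⊕ bag b)
join-above m a b na hj u z p with join-node m a b na
... | l , r , e = ≤∧≢⇒< m≤z m≢z
  where
  m≤z : m ≤ z
  m≤z = subst (_≤ z) (cong root e)
          (Heap-root≤ (join m a b) hj z (subst (0 <_) (sym (bag-join m a b na z)) (<-≤-trans p (m≤n+m _ (δ z m)))))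
  m≢z : m ≢ z
  m≢z refl = <⇒≱ p (≤-pred (subst (_≤ 1) (trans (bag-join m a b na m) (cong (_+ (bag a m + bag b m)) (δ-refl m))) (u m)))

join-distinct : ∀ m a b → IsNode a → Distinct (bag (join m a b)) → Distinct (bag a ⊕ bag b)
join-distinct m a b na u = Distinct-mono u (λ z → subst (bag a z + bag b z ≤_) (sym (bag-join m a b na z)) (m≤n+m _ (δ z m)))

-- The conditions under which join m a b is again an Alt heap (and can be split back).
record Joinable (m : ℕ) (a b : BinTree) : Set where
  constructor joinable
  field
    {pa pb} : Bool
    alt-a : Alt pa a
    alt-b : Alt pb b
    heap-a : Heap a
    heap-b : Heap b
    node-a : IsNode a
    ordered : Every (root a <_) (bag b)
    above : Every (m <_) (bag a ⊕ bag b)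
    distinct : Distinct (bag a ⊕ bag b)

joinable-of : ∀ {m a b x pa pb} → Alt pa a → Alt pb b → Heap a → Heap b → IsNode a → Every (root a <_) (bag b) →
  join m a b ≡ x → Heap x → Distinct (bag x) → Joinable m a b
joinable-of {m} {a} {b} da db ha hb na ord refl hx u = joinable da db ha hb na ord (join-above m a b na hx u) (join-distinct m a b na u)

join-ok : ∀ {m a b} → Joinable m a b → Σ Bool (λ c → Alt c (join m a b)) × Heap (join m a b)
join-ok {m} {a} {b} (joinable {true} {pb} da db ha hb _ _ above _) rewrite join-odd m a b da =
  (pb , alt-node da db) , (Every-⊕ˡ {f = bag a} above , Every-⊕ʳ {f = bag a} above , ha , hb)
join-ok (joinable {false} alt-∅ _ _ _ (_ , _ , _ , ()) _ _ _)
join-ok {m} {node α μ a} {b} (joinable {false} {true} (alt-node dα da) db (hα′ , ha′ , hα , ha) hb _ ord above _)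
  rewrite join-even m α μ a b dα da | joinEven-odd m α μ a b db =
  (false , alt-node dα (alt-node db da)) ,
  (Every-nodeˡ {l = α} {μ} {a} ma , Every-node {l = b} {μ} {a} mb (Every-node-root {l = α} {μ} {a} ma) (Every-nodeʳ {l = α} {μ} {a} ma) ,
   hα , (ord , ha′ , hb , ha))
  where ma = Every-⊕ˡ {f = bag (node α μ a)} above
        mb = Every-⊕ʳ {f = bag (node α μ a)} above
join-ok {m} {node α μ a} {b} (joinable {false} {false} (alt-node dα da) db (hα′ , ha′ , hα , ha) hb _ ord above u)
  rewrite join-even m α μ a b dα da | joinEven-even m α μ a b db
  with sink-ok μ a b da db ha hb (Every-⊕ ha′ ord) (Distinct-⊕-mono u (bag-right≤ α μ a) (λ _ → ≤-refl))
... | ds , hs = (true , alt-node dα ds) , (Every-nodeˡ {l = α} {μ} {a} ma , Every-≗ (bag-sink μ a b) below-m , hα , hs)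
  where ma = Every-⊕ˡ {f = bag (node α μ a)} above
        below-m : Every (m <_) (⟦ μ ⟧ ⊕ bag a ⊕ bag b)
        below-m = Every-δ+ (Every-node-root {l = α} {μ} {a} ma) (Every-⊕ (Every-nodeʳ {l = α} {μ} {a} ma) (Every-⊕ʳ {f = bag (node α μ a)} above))

leftmost-join : ∀ {m a b} → Joinable m a b → leftmost (join m a b) ≡ leftmost a
leftmost-join {m} {a} {b} (joinable {true} da _ _ _ _ _ _ _) rewrite join-odd m a b da = leftmost-node a m b da
leftmost-join (joinable {false} alt-∅ _ _ _ (_ , _ , _ , ()) _ _ _)
leftmost-join {m} {node α μ a} {b} (joinable {false} {true} (alt-node dα da) db _ _ _ _ _ _)
  rewrite join-even m α μ a b dα da | joinEven-odd m α μ a b db = trans (leftmost-node α m _ dα) (sym (leftmost-node α μ a dα))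
leftmost-join {m} {node α μ a} {b} (joinable {false} {false} (alt-node dα da) db _ _ _ _ _ _)
  rewrite join-even m α μ a b dα da | joinEven-even m α μ a b db = trans (leftmost-node α m _ dα) (sym (leftmost-node α μ a dα))

encode-ok : ∀ t → Increasing t → Distinct (bagT t) → Σ Bool (λ c → Alt c (encode t)) × Heap (encode t)
joinable-one : ∀ m t → Increasing (one m t) → Distinct (bagT (one m t)) → Joinable m (encode t) ∅
joinable-two : ∀ m s t → Increasing (two m s t) → Distinct (bagT (two m s t)) → Joinable m (encode s) (encode t)
encode-ok (tip m) _ _ = (true , alt-tip m) , (Every-∅ , Every-∅ , tt , tt)
encode-ok (one m t) it u = join-ok (joinable-one m t it u)
encode-ok (two m s t) it u = join-ok (joinable-two m s t it u)
joinable-one m t (mt , it) u with encode-ok t it (Distinct-one m t u)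
... | (_ , dt) , ht = joinable dt alt-∅ ht tt (encode-IsNode t) Every-∅ above distinct
  where above : Every (m <_) (bag (encode t) ⊕ bag ∅)
        above = Every-≗ (λ a → trans (+-identityʳ _) (bag-encode t a)) mt
        distinct : Distinct (bag (encode t) ⊕ bag ∅)
        distinct = Distinct-≗ (λ a → trans (+-identityʳ _) (bag-encode t a)) (Distinct-one m t u)
joinable-two m s t (ms , mt , s<t , is , it) u
  with encode-ok s is (Distinct-⊕ˡ {bagT s} (Distinct-two m s t u)) | encode-ok t it (Distinct-⊕ʳ {bagT s} (Distinct-two m s t u))
... | (_ , ds) , hs | (_ , dt) , ht = joinable ds dt hs ht (encode-IsNode s) ordered (Every-≗ bags (Every-⊕ ms mt)) (Distinct-≗ bags (Distinct-two m s t u))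
  where bags : bag (encode s) ⊕ bag (encode t) ≗ bagT s ⊕ bagT t
        bags a = cong₂ _+_ (bag-encode s a) (bag-encode t a)
        ordered : Every (root (encode s) <_) (bag (encode t))
        ordered = Every-≗ (bag-encode t) (subst (λ k → Every (k <_) (bagT t)) (sym (encode-root s)) (Every-mono (<-≤-trans s<t) (Increasing-top≤ t it)))

-- Decoding an Alt heap

-- split l r recovers the pair (a , b) with join m a b ≡ node l m r: the labels root l and
-- root r tell whether m displaced the root of a, and the parity of the rest tells how.
split : BinTree → BinTree → BinTree × BinTree
split l ∅ = l , ∅
split l (node b μ c) with root l <? μ
... | yes _ = l , node b μ c
split l (node ∅ μ c) | no _ = node l μ ∅ , ∅
split l (node (node b₁ b₂ b₃) μ c) | no _ with oddSize c
... | false = node l μ c , node b₁ b₂ b₃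
... | true = node l μ (proj₁ (merge (node b₁ b₂ b₃) c)) , proj₂ (merge (node b₁ b₂ b₃) c)

oneOrTwo : ℕ → Tree → BinTree → Tree → Tree
oneOrTwo m s ∅ t = one m s
oneOrTwo m s (node _ _ _) t = two m s t

-- decode f x is meant for size x ≤ f; the fuel only makes the recursion structural.
decode : ℕ → BinTree → Tree
decode zero _ = tip 0
decode (suc f) ∅ = tip 0
decode (suc f) (node ∅ m _) = tip m
decode (suc f) (node l@(node _ _ _) m r) =
  oneOrTwo m (decode f (proj₁ (split l r))) (proj₂ (split l r)) (decode f (proj₂ (split l r)))

decode-node : ∀ f l m r → IsNode l →
  decode (suc f) (node l m r) ≡ oneOrTwo m (decode f (proj₁ (split l r))) (proj₂ (split l r)) (decode f (proj₂ (split l r)))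
decode-node f _ m r (_ , _ , _ , refl) = refl

oneOrTwo-node : ∀ m s b t → IsNode b → oneOrTwo m s b t ≡ two m s t
oneOrTwo-node m s _ t (_ , _ , _ , refl) = refl

split-< : ∀ l b μ c → root l < μ → split l (node b μ c) ≡ (l , node b μ c)
split-< l b μ c lt with root l <? μ
... | yes _ = refl
... | no l≮μ = ⊥-elim (l≮μ lt)

split-≮-tip : ∀ l μ c → ¬ root l < μ → split l (node ∅ μ c) ≡ (node l μ ∅ , ∅)
split-≮-tip l μ c l≮μ with root l <? μ
... | yes lt = ⊥-elim (l≮μ lt)
... | no _ = refl

split-≮-even : ∀ l b μ c → ¬ root l < μ → IsNode b → Alt false c → split l (node b μ c) ≡ (node l μ c , b)
split-≮-even l _ μ c l≮μ (_ , _ , _ , refl) dc with root l <? μ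
... | yes lt = ⊥-elim (l≮μ lt)
... | no _ rewrite Alt-oddSize dc = refl

split-≮-odd : ∀ l b μ c → ¬ root l < μ → IsNode b → Alt true c →
  split l (node b μ c) ≡ (node l μ (proj₁ (merge b c)) , proj₂ (merge b c))
split-≮-odd l _ μ c l≮μ (_ , _ , _ , refl) dc with root l <? μ
... | yes lt = ⊥-elim (l≮μ lt)
... | no _ rewrite Alt-oddSize dc = refl

split-join-sink : ∀ m α μ a b → Alt true α → Alt false a → Alt false b → Every (μ <_) (bag α) → Heap a → Heap b →
  Distinct (bag a ⊕ bag b) → NotBoth∅ (a , b) →
  Σ BinTree λ l → Σ BinTree λ r → join m (node α μ a) b ≡ node l m r × IsNode l × split l r ≡ (node α μ a , b)
split-join-sink m α μ a b dα da db μ<α ha hb u nb with unmerge-ok a b da db ha hb u nb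
... | (dβ₁ , dβ₂ , _) , back =
  α , sink μ a b , trans (join-even m α μ a b dα da) (joinEven-even m α μ a b db) , odd⇒IsNode dα ,
  trans (split-≮-odd α _ μ _ (Every<⇒root≮ dα μ<α) (odd⇒IsNode dβ₁) dβ₂) (cong (λ p → node α μ (proj₁ p) , proj₂ p) back)

split-join : ∀ {m a b} → Joinable m a b →
  Σ BinTree λ l → Σ BinTree λ r → join m a b ≡ node l m r × IsNode l × split l r ≡ (a , b)
split-join {m} {a} {∅} (joinable {true} da _ _ _ na _ _ _) = a , ∅ , join-odd m a ∅ da , na , refl
split-join {m} {a} {node b μ c} (joinable {true} da _ _ _ na ord _ _) =
  a , node b μ c , join-odd m a (node b μ c) da , na , split-< a b μ c (ord μ (root∈bag b μ c))
split-join (joinable {false} alt-∅ _ _ _ (_ , _ , _ , ()) _ _ _)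
split-join {m} {node α μ a} {b} (joinable {false} {true} (alt-node dα da) db (μ<α , _) _ _ _ _ _) =
  α , node b μ a , trans (join-even m α μ a b dα da) (joinEven-odd m α μ a b db) , odd⇒IsNode dα ,
  split-≮-even α b μ a (Every<⇒root≮ dα μ<α) (odd⇒IsNode db) da
split-join {m} {node α μ ∅} {∅} (joinable {false} {false} (alt-node dα da) db (μ<α , _) _ _ _ _ _) =
  α , node ∅ μ ∅ , trans (join-even m α μ ∅ ∅ dα da) (joinEven-even m α μ ∅ ∅ db) , odd⇒IsNode dα ,
  split-≮-tip α μ ∅ (Every<⇒root≮ dα μ<α)
split-join {m} {node α μ a@(node _ _ _)} {b} (joinable {false} {false} (alt-node dα da) db (μ<α , _ , _ , ha) hb _ _ _ u) =
  split-join-sink m α μ a b dα da db μ<α ha hb (Distinct-⊕-mono u (bag-right≤ α μ a) (λ _ → ≤-refl)) left-node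
split-join {m} {node α μ ∅} {b@(node _ _ _)} (joinable {false} {false} (alt-node dα da) db (μ<α , _ , _ , ha) hb _ _ _ u) =
  split-join-sink m α μ ∅ b dα da db μ<α ha hb (Distinct-⊕-mono u (bag-right≤ α μ ∅) (λ _ → ≤-refl)) right-node

below-left-root : ∀ l m b μ c → Alt true l → Heap l → Distinct (bag (node l m (node b μ c))) → ¬ root l < μ → Every (μ <_) (bag l)
below-left-root l m b μ c dl hl u l≮μ =
  Heap-root< l hl (≮∧≢⇒> l≮μ (Distinct-⊕⇒≢ {bag l} {bag (node b μ c)} (Distinct-children l m (node b μ c) u) (odd-root∈bag dl) (root∈bag b μ c)))

split-ok : ∀ l m r {p} → Alt p (node l m r) → Heap (node l m r) → Distinct (bag (node l m r)) → IsNode l →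
  Joinable m (proj₁ (split l r)) (proj₂ (split l r)) × join m (proj₁ (split l r)) (proj₂ (split l r)) ≡ node l m r
split-ok l m ∅ (alt-node dl alt-∅) hx@(_ , _ , hl , _) u nl = joinable-of dl alt-∅ hl tt nl Every-∅ eq hx u , eq
  where eq = join-odd m l ∅ dl
split-ok l m (node b μ c) dx hx u nl with root l <? μ
split-ok l m (node b μ c) (alt-node dl dr) hx@(_ , _ , hl , hr) u nl | yes l<μ =
  joinable-of dl dr hl hr nl (Heap-root< (node b μ c) hr l<μ) eq hx u , eq
  where eq = join-odd m l (node b μ c) dl
split-ok l m (node ∅ μ ∅) (alt-node dl (alt-tip μ)) hx@(_ , _ , hl , _) u nl | no l≮μ =
  joinable-of (alt-node dl alt-∅) alt-∅ (below-left-root l m ∅ μ ∅ dl hl u l≮μ , Every-∅ , hl , tt) tt (l , μ , ∅ , refl) Every-∅ eq hx u , eq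
  where eq = trans (join-even m l μ ∅ ∅ dl alt-∅) (joinEven-even m l μ ∅ ∅ alt-∅)
split-ok l m (node ∅ μ c) (alt-node dl (alt-node () _)) hx u nl | no _
split-ok l m (node b@(node _ _ _) μ c) (alt-node dl (alt-node {b = false} db dc)) hx@(_ , _ , hl , (μ<b , μ<c , hb , hc)) u nl | no l≮μ
  rewrite Alt-oddSize dc =
  joinable-of (alt-node dl dc) db (below-left-root l m b μ c dl hl u l≮μ , μ<c , hl , hc) hb (l , μ , c , refl) μ<b eq hx u , eq
  where eq = trans (join-even m l μ c b dl dc) (joinEven-odd m l μ c b db)
split-ok l m (node b@(node _ _ _) μ c) (alt-node dl (alt-node {b = true} db dc)) hx@(_ , _ , hl , (μ<b , μ<c , hb , hc)) u nl | no l≮μ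
  rewrite Alt-oddSize dc
  with merge-ok b c db dc hb hc u′ | unmerge-merge b c db dc hb hc u′
  where u′ = Distinct-children b μ c (Distinct-⊕ʳ {bag l} (Distinct-children l m (node b μ c) u))
... | (de , dd , he , hd) , _ | back =
  joinable-of (alt-node dl de) dd (below-left-root l m b μ c dl hl u l≮μ , Every-⊕ˡ {f = bag e} μ<ed , hl , he) hd (l , μ , e , refl)
              (Every-⊕ʳ {f = bag e} μ<ed) eq hx u , eq
  where e = proj₁ (merge b c)
        d = proj₂ (merge b c)
        μ<ed = Every-≗ (merge-bag b c db dc) (Every-⊕ μ<b μ<c)
        eq = trans (join-even m l μ e d dl de) (trans (joinEven-even m l μ e d dd) (cong (λ p → node l m (node (proj₁ p) μ (proj₂ p))) back))

decode-join : ∀ {m a b} → Joinable m a b → ∀ f → decode (suc f) (join m a b) ≡ oneOrTwo m (decode f a) b (decode f b)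
decode-join {m} J f with split-join J
... | l , r , eq , nl , sp rewrite eq =
  trans (decode-node f l m r nl) (cong (λ p → oneOrTwo m (decode f (proj₁ p)) (proj₂ p) (decode f (proj₂ p))) sp)

decode-encode : ∀ t f → Increasing t → Distinct (bagT t) → order t ≤ f → decode f (encode t) ≡ t
decode-encode (tip m) (suc f) _ _ _ = refl
decode-encode (one m t) (suc f) it u (s≤s le) =
  trans (decode-join (joinable-one m t it u) f) (cong (one m) (decode-encode t f (proj₂ it) (Distinct-one m t u) le))
decode-encode (two m s t) (suc f) it@(_ , _ , _ , is , it′) u le = begin
  decode (suc f) (join m (encode s) (encode t))                       ≡⟨ decode-join (joinable-two m s t it u) f ⟩
  oneOrTwo m (decode f (encode s)) (encode t) (decode f (encode t))   ≡⟨ oneOrTwo-node m _ (encode t) _ (encode-IsNode t) ⟩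
  two m (decode f (encode s)) (decode f (encode t))                   ≡⟨ cong₂ (two m) (decode-encode s f is us order-s) (decode-encode t f it′ ut order-t) ⟩
  two m s t                                                           ∎
  where
  open ≡-Reasoning
  us = Distinct-⊕ˡ {bagT s} (Distinct-two m s t u)
  ut = Distinct-⊕ʳ {bagT s} (Distinct-two m s t u)
  sizes : order s + order t ≤ f
  sizes = ≤-pred (subst (_≤ suc f) (order-two m s t) le)
  order-s = ≤-trans (m≤m+n (order s) (order t)) sizes
  order-t = ≤-trans (m≤n+m (order t) (order s)) sizes

Decodes : BinTree → Tree → Set
Decodes x t = encode t ≡ x × Increasing t × minLeaf t ≡ leftmost x

Decodes-bag : ∀ {x t} → Decodes x t → bagT t ≗ bag x
Decodes-bag {t = t} (e , _) a = trans (sym (bag-encode t a)) (cong (λ z → bag z a) e)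

Decodes-top : ∀ {x t} → Decodes x t → top t ≡ root x
Decodes-top {t = t} (e , _) = trans (sym (encode-root t)) (cong root e)

oneOrTwo-ok : ∀ {m a b x s t} → Joinable m a b → join m a b ≡ x → Decodes a s → (IsNode b → Decodes b t) →
  Decodes x (oneOrTwo m s b t)
oneOrTwo-ok {m} {a} {∅} J refl ds@(es , is , ls) _ =
  cong (λ z → join m z ∅) es , (Every-≗ (Decodes-bag ds) (Every-⊕ˡ {f = bag a} above) , is) , trans ls (sym (leftmost-join J))
  where open Joinable J
oneOrTwo-ok {m} {a} {node b₁ μ b₂} J refl ds@(es , is , ls) dt with dt (b₁ , μ , b₂ , refl)
... | dt′@(et , it , _) =
  cong₂ (join m) es et ,
  (Every-≗ (Decodes-bag ds) (Every-⊕ˡ {f = bag a} above) , Every-≗ (Decodes-bag dt′) (Every-⊕ʳ {f = bag a} above) ,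
   subst₂ _<_ (sym (Decodes-top ds)) (sym (Decodes-top dt′)) (ordered μ (root∈bag b₁ μ b₂)) , is , it) ,
  trans ls (sym (leftmost-join J))
  where open Joinable J

decode-ok : ∀ f x {p} → Alt p x → Heap x → Distinct (bag x) → IsNode x → size x ≤ f → Decodes x (decode f x)
decode-ok zero (node l m r) _ _ _ _ le = ⊥-elim (<⇒≱ (size-node>0 l m r) le)
decode-ok (suc f) (node ∅ m ∅) (alt-tip m) _ _ _ _ = refl , tt , refl
decode-ok (suc f) (node ∅ m r) (alt-node () _) _ _ _ _
decode-ok (suc f) (node l@(node _ _ _) m r) dx hx u _ le with split-ok l m r dx hx u (_ , _ , _ , refl)
... | J , eq =
  oneOrTwo-ok J eq (decode-ok f a alt-a heap-a (Distinct-⊕ˡ {bag a} distinct) node-a (≤-trans (m≤m+n _ _) sizes))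
                   (λ nb → decode-ok f b alt-b heap-b (Distinct-⊕ʳ {bag a} distinct) nb (≤-trans (m≤n+m _ _) sizes))
  where
  open Joinable J
  a = proj₁ (split l r)
  b = proj₂ (split l r)
  sizes : size a + size b ≤ f
  sizes = ≤-pred (subst (_≤ suc f) (trans (sym (cong size eq)) (size-join m a b node-a)) le)

-- Parent functions

-- parentOf t j is 0 unless j is a vertex of t, so in the binary case the sum picks the subtree holding j.
parentOf : Tree → ℕ → ℕ
parentOf (tip m) j = 0
parentOf (one m c) j with j ≟ top c
... | yes _ = m
... | no _ = parentOf c j
parentOf (two m a b) j with j ≟ top a
... | yes _ = m
... | no _ with j ≟ top b
...   | yes _ = m
...   | no _ = parentOf a j + parentOf b j

data _⊑_ : Tree → Tree → Set where
  ⊑-refl : ∀ {t} → t ⊑ t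
  ⊑-one : ∀ {s m c} → s ⊑ c → s ⊑ one m c
  ⊑-left : ∀ {s m a b} → s ⊑ a → s ⊑ two m a b
  ⊑-right : ∀ {s m a b} → s ⊑ b → s ⊑ two m a b

⊑-trans : ∀ {s u t} → s ⊑ u → u ⊑ t → s ⊑ t
⊑-trans p ⊑-refl = p
⊑-trans p (⊑-one q) = ⊑-one (⊑-trans p q)
⊑-trans p (⊑-left q) = ⊑-left (⊑-trans p q)
⊑-trans p (⊑-right q) = ⊑-right (⊑-trans p q)

children : Tree → List ℕ
children (tip m) = []
children (one m c) = top c ∷ []
children (two m a b) = top a ∷ top b ∷ []

two-sorted : ∀ {m a b} → Increasing (two m a b) → top a < top b
two-sorted (_ , _ , a<b , _) = a<b

Increasing-twoˡ : ∀ {m a b} → Increasing (two m a b) → Increasing a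
Increasing-twoˡ (_ , _ , _ , ia , _) = ia

Increasing-twoʳ : ∀ {m a b} → Increasing (two m a b) → Increasing b
Increasing-twoʳ (_ , _ , _ , _ , ib) = ib

Valid : Tree → Set
Valid t = Increasing t × Distinct (bagT t)

top∈bagT : ∀ t → 0 < bagT t (top t)
top∈bagT (tip m) rewrite δ-refl m = s≤s z≤n
top∈bagT (one m c) rewrite δ-refl m = s≤s z≤n
top∈bagT (two m a b) rewrite δ-refl m = s≤s z≤n

Valid-one : ∀ {m c} → Valid (one m c) → Valid c
Valid-one {m} {c} ((_ , w) , u) = w , Distinct-mono u (λ a → m≤n+m (bagT c a) (δ a m))

Valid-twoˡ : ∀ {m a b} → Valid (two m a b) → Valid a
Valid-twoˡ {m} {a} {b} ((_ , _ , _ , w , _) , u) = w , Distinct-mono u (λ z → ≤-trans (m≤m+n (bagT a z) (bagT b z)) (≤-trans (m≤n+m _ (δ z m)) (≤-reflexive (sym (bagT-two m a b z)))))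

Valid-twoʳ : ∀ {m a b} → Valid (two m a b) → Valid b
Valid-twoʳ {m} {a} {b} ((_ , _ , _ , _ , w) , u) = w , Distinct-mono u (λ z → ≤-trans (m≤n+m (bagT b z) (bagT a z)) (≤-trans (m≤n+m _ (δ z m)) (≤-reflexive (sym (bagT-two m a b z)))))

Valid-two-disjoint : ∀ {m a b x y} → Valid (two m a b) → 0 < bagT a x → 0 < bagT b y → x ≢ y
Valid-two-disjoint {m} {a} {b} (_ , u) px py = Distinct-⊕⇒≢ {bagT a} {bagT b} (Distinct-mono u (λ z → ≤-trans (m≤n+m _ (δ z m)) (≤-reflexive (sym (bagT-two m a b z))))) px py

∈-one : ∀ {m c j} → 0 < bagT c j → 0 < bagT (one m c) j
∈-one {m} {c} {j} p = <-≤-trans p (m≤n+m _ (δ j m))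

∈-twoˡ : ∀ {m a b j} → 0 < bagT a j → 0 < bagT (two m a b) j
∈-twoˡ {m} {a} {b} {j} p = subst (0 <_) (sym (bagT-two m a b j)) (<-≤-trans p (≤-trans (m≤m+n (bagT a j) (bagT b j)) (m≤n+m _ (δ j m))))

∈-twoʳ : ∀ {m a b j} → 0 < bagT b j → 0 < bagT (two m a b) j
∈-twoʳ {m} {a} {b} {j} p = subst (0 <_) (sym (bagT-two m a b j)) (<-≤-trans p (≤-trans (m≤n+m (bagT b j) (bagT a j)) (m≤n+m _ (δ j m))))

∈-⊑ : ∀ {s t j} → s ⊑ t → 0 < bagT s j → 0 < bagT t j
∈-⊑ ⊑-refl p = p
∈-⊑ (⊑-one {m = m} {c} q) p = ∈-one {m} {c} (∈-⊑ q p)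
∈-⊑ (⊑-left {m = m} {a} {b} q) p = ∈-twoˡ {m} {a} {b} (∈-⊑ q p)
∈-⊑ (⊑-right {m = m} {a} {b} q) p = ∈-twoʳ {m} {a} {b} (∈-⊑ q p)

Increasing-top< : ∀ t → Increasing t → ∀ j → 0 < bagT t j → j ≢ top t → top t < j
Increasing-top< t w j p ne = ≤∧≢⇒< (Increasing-top≤ t w j p) (λ e → ne (sym e))

child-top : ∀ s {c} → Increasing s → c ∈ children s → 0 < bagT s c × top s < c
child-top (tip m) _ ()
child-top (one m c) (h , _) (here refl) = ∈-one {m} {c} (top∈bagT c) , h (top c) (top∈bagT c)
child-top (two m a b) (ha , _) (here refl) = ∈-twoˡ {m} {a} {b} (top∈bagT a) , ha (top a) (top∈bagT a)
child-top (two m a b) (_ , hb , _) (there (here refl)) = ∈-twoʳ {m} {a} {b} (top∈bagT b) , hb (top b) (top∈bagT b)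

parentOf-∉ : ∀ t j → bagT t j ≡ 0 → parentOf t j ≡ 0
parentOf-∉ (tip m) j _ = refl
parentOf-∉ (one m c) j z with j ≟ top c
... | yes refl = ⊥-elim (<⇒≢ (top∈bagT c) (sym (m+n≡0⇒n≡0 (δ (top c) m) z)))
... | no _ = parentOf-∉ c j (m+n≡0⇒n≡0 (δ j m) z)
parentOf-∉ (two m a b) j z with j ≟ top a | trans (sym (bagT-two m a b j)) z
... | yes refl | z' = ⊥-elim (<⇒≢ (top∈bagT a) (sym (m+n≡0⇒m≡0 _ (m+n≡0⇒n≡0 (δ (top a) m) z'))))
... | no _ | z' with j ≟ top b
...   | yes refl = ⊥-elim (<⇒≢ (top∈bagT b) (sym (m+n≡0⇒n≡0 (bagT a (top b)) (m+n≡0⇒n≡0 (δ (top b) m) z'))))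
...   | no _ rewrite parentOf-∉ a j (m+n≡0⇒m≡0 _ (m+n≡0⇒n≡0 (δ j m) z')) | parentOf-∉ b j (m+n≡0⇒n≡0 (bagT a j) (m+n≡0⇒n≡0 (δ j m) z')) = refl

Valid-two-∉ʳ : ∀ {m a b j} → Valid (two m a b) → 0 < bagT a j → bagT b j ≡ 0
Valid-two-∉ʳ {m} {a} {b} {j} v p with bagT b j in eq
... | zero = refl
... | suc _ = ⊥-elim (Valid-two-disjoint {m} {a} {b} v p (subst (0 <_) (sym eq) (s≤s z≤n)) refl)

Valid-two-∉ˡ : ∀ {m a b j} → Valid (two m a b) → 0 < bagT b j → bagT a j ≡ 0
Valid-two-∉ˡ {m} {a} {b} {j} v p with bagT a j in eq
... | zero = refl
... | suc _ = ⊥-elim (Valid-two-disjoint {m} {a} {b} v (subst (0 <_) (sym eq) (s≤s z≤n)) p refl)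

Increasing-⊑ : ∀ {s t} → s ⊑ t → Increasing t → Increasing s
Increasing-⊑ ⊑-refl w = w
Increasing-⊑ (⊑-one q) (_ , w) = Increasing-⊑ q w
Increasing-⊑ (⊑-left q) (_ , _ , _ , w , _) = Increasing-⊑ q w
Increasing-⊑ (⊑-right q) (_ , _ , _ , _ , w) = Increasing-⊑ q w

child≢top : ∀ {s c k} → s ⊑ c → Increasing c → k ∈ children s → k ≢ top c × 0 < bagT c k
child≢top {s} {c} {k} q w mem with child-top s (Increasing-⊑ q w) mem
... | pin , lt = (λ e → <-irrefl refl (<-≤-trans lt (subst (_≤ top s) (sym e) (Increasing-top≤ c w (top s) (∈-⊑ q (top∈bagT s)))))) , ∈-⊑ q pin

parentOf-child : ∀ {s t c} → Valid t → s ⊑ t → c ∈ children s → parentOf t c ≡ top s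
parentOf-child {one m c'} {.(one m c')} {.(top c')} v ⊑-refl (here refl) with top c' ≟ top c'
... | yes _ = refl
... | no n = ⊥-elim (n refl)
parentOf-child {two m a b} {.(two m a b)} {.(top a)} v ⊑-refl (here refl) with top a ≟ top a
... | yes _ = refl
... | no n = ⊥-elim (n refl)
parentOf-child {two m a b} {.(two m a b)} {.(top b)} v ⊑-refl (there (here refl)) with top b ≟ top a
... | yes e = ⊥-elim (Valid-two-disjoint {m} {a} {b} v (top∈bagT a) (top∈bagT b) (sym e))
... | no _ with top b ≟ top b
...   | yes _ = refl
...   | no n = ⊥-elim (n refl)
parentOf-child {s} {one m c'} {c} v (⊑-one q) mem with c ≟ top c' | child≢top q (proj₁ (Valid-one v)) mem
... | yes e | ne , _ = ⊥-elim (ne e)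
... | no _ | _ = parentOf-child (Valid-one v) q mem
parentOf-child {s} {two m a b} {c} v (⊑-left q) mem with child≢top q (Increasing-⊑ (⊑-left {m = m} {b = b} ⊑-refl) (proj₁ v)) mem
... | ne , cin with c ≟ top a
...   | yes e = ⊥-elim (ne e)
...   | no _ with c ≟ top b
...     | yes e = ⊥-elim (Valid-two-disjoint {m} {a} {b} v cin (top∈bagT b) e)
...     | no _ rewrite parentOf-∉ b c (Valid-two-∉ʳ {m} {a} {b} v cin) | +-identityʳ (parentOf a c) = parentOf-child (Valid-twoˡ v) q mem
parentOf-child {s} {two m a b} {c} v (⊑-right q) mem with child≢top q (Increasing-⊑ (⊑-right {m = m} {a = a} ⊑-refl) (proj₁ v)) mem
... | ne , cin with c ≟ top a
...   | yes e = ⊥-elim (Valid-two-disjoint {m} {a} {b} v (top∈bagT a) cin (sym e))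
...   | no _ with c ≟ top b
...     | yes e = ⊥-elim (ne e)
...     | no _ rewrite parentOf-∉ a c (Valid-two-∉ˡ {m} {a} {b} v cin) = parentOf-child (Valid-twoʳ v) q mem

parent-exists : ∀ t j → Valid t → 0 < bagT t j → j ≢ top t → Σ Tree λ s → s ⊑ t × j ∈ children s
parent-exists (tip m) j v p ne = ⊥-elim (ne (δ>0⇒≡ (subst (0 <_) (+-identityʳ (δ j m)) p)))
parent-exists (one m c) j v p ne with j ≟ top c
... | yes refl = one m c , ⊑-refl , here refl
... | no ne' with parent-exists c j (Valid-one v) (subst (0 <_) (cong (_+ bagT c j) (δ-≢ ne)) p) ne'
...   | s , q , mem = s , ⊑-one q , mem
parent-exists (two m a b) j v p ne with j ≟ top a
... | yes refl = two m a b , ⊑-refl , here refl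
... | no nea with j ≟ top b
...   | yes refl = two m a b , ⊑-refl , there (here refl)
...   | no neb with +-pos-split (bagT a j) (bagT b j) (subst (0 <_) (trans (bagT-two m a b j) (cong (_+ (bagT a j + bagT b j)) (δ-≢ ne))) p)
...     | inj₁ pa with parent-exists a j (Valid-twoˡ v) pa nea
...       | s , q , mem = s , ⊑-left q , mem
parent-exists (two m a b) j v p ne | no nea | no neb | inj₂ pb with parent-exists b j (Valid-twoʳ v) pb neb
...       | s , q , mem = s , ⊑-right q , mem

top<-one : ∀ {s m c} → Increasing (one m c) → s ⊑ c → m < top s
top<-one {s} (h , _) q = h (top s) (∈-⊑ q (top∈bagT s))

top<-left : ∀ {s m a b} → Increasing (two m a b) → s ⊑ a → m < top s
top<-left {s} (h , _) q = h (top s) (∈-⊑ q (top∈bagT s))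

top<-right : ∀ {s m a b} → Increasing (two m a b) → s ⊑ b → m < top s
top<-right {s} (_ , h , _) q = h (top s) (∈-⊑ q (top∈bagT s))

⊑-top-injective : ∀ {s s' t} → Valid t → s ⊑ t → s' ⊑ t → top s ≡ top s' → s ≡ s'
⊑-top-injective v ⊑-refl ⊑-refl e = refl
⊑-top-injective v ⊑-refl (⊑-one q) e = ⊥-elim (<⇒≢ (top<-one (proj₁ v) q) e)
⊑-top-injective v ⊑-refl (⊑-left q) e = ⊥-elim (<⇒≢ (top<-left (proj₁ v) q) e)
⊑-top-injective v ⊑-refl (⊑-right q) e = ⊥-elim (<⇒≢ (top<-right (proj₁ v) q) e)
⊑-top-injective v (⊑-one q) ⊑-refl e = ⊥-elim (<⇒≢ (top<-one (proj₁ v) q) (sym e))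
⊑-top-injective v (⊑-left q) ⊑-refl e = ⊥-elim (<⇒≢ (top<-left (proj₁ v) q) (sym e))
⊑-top-injective v (⊑-right q) ⊑-refl e = ⊥-elim (<⇒≢ (top<-right (proj₁ v) q) (sym e))
⊑-top-injective v (⊑-one q) (⊑-one q') e = ⊑-top-injective (Valid-one v) q q' e
⊑-top-injective v (⊑-left q) (⊑-left q') e = ⊑-top-injective (Valid-twoˡ v) q q' e
⊑-top-injective v (⊑-right q) (⊑-right q') e = ⊑-top-injective (Valid-twoʳ v) q q' e
⊑-top-injective {s} {s'} {two m a b} v (⊑-left q) (⊑-right q') e = ⊥-elim (Valid-two-disjoint {m} {a} {b} v (∈-⊑ q (top∈bagT s)) (∈-⊑ q' (top∈bagT s')) e)
⊑-top-injective {s} {s'} {two m a b} v (⊑-right q) (⊑-left q') e = ⊥-elim (Valid-two-disjoint {m} {a} {b} v (∈-⊑ q' (top∈bagT s')) (∈-⊑ q (top∈bagT s)) (sym e))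

parentOf⇒child : ∀ {s t j} → Valid t → s ⊑ t → 0 < bagT t j → j ≢ top t → parentOf t j ≡ top s → j ∈ children s
parentOf⇒child {s} {t} {j} v q p ne e with parent-exists t j v p ne
... | s' , q' , mem with ⊑-top-injective v q q' (trans (sym e) (parentOf-child v q' mem))
... | refl = mem

parentOf-< : ∀ t j → Valid t → 0 < bagT t j → j ≢ top t → parentOf t j < j × 0 < bagT t (parentOf t j)
parentOf-< t j v p ne with parent-exists t j v p ne
... | s , q , mem rewrite parentOf-child v q mem = proj₂ (child-top s (Increasing-⊑ q (proj₁ v)) mem) , ∈-⊑ q (top∈bagT s)

pigeonhole : ∀ (ks : List ℕ) {j k l} → length ks ≤ 2 → j ∈ ks → k ∈ ks → l ∈ ks → j ≡ k ⊎ j ≡ l ⊎ k ≡ l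
pigeonhole (x ∷ ks) _ (here refl) (here refl) _ = inj₁ refl
pigeonhole (x ∷ ks) _ (here refl) (there _) (here refl) = inj₂ (inj₁ refl)
pigeonhole (x ∷ ks) _ (there _) (here refl) (here refl) = inj₂ (inj₂ refl)
pigeonhole (x ∷ y ∷ ks) _ (there (here refl)) (there (here refl)) _ = inj₁ refl
pigeonhole (x ∷ y ∷ ks) _ (there (here refl)) (here refl) (there (here refl)) = inj₂ (inj₁ refl)
pigeonhole (x ∷ y ∷ ks) _ (here refl) (there (here refl)) (there (here refl)) = inj₂ (inj₂ refl)
pigeonhole (x ∷ y ∷ []) _ (there (there ())) _ _
pigeonhole (x ∷ y ∷ []) _ _ (there (there ())) _
pigeonhole (x ∷ y ∷ []) _ _ _ (there (there ()))
pigeonhole (x ∷ y ∷ z ∷ ks) (s≤s (s≤s ())) _ _ _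

children-length : ∀ s → length (children s) ≤ 2
children-length (tip _) = z≤n
children-length (one _ _) = s≤s z≤n
children-length (two _ _ _) = s≤s (s≤s z≤n)

record TreeOn (n : ℕ) (t : Tree) : Set where
  constructor treeOn
  field
    valid : Valid t
    top≡1 : top t ≡ 1
    labels : bagT t ≗ count [ n ]

module _ {n t} (tv : TreeOn n t) where
  open TreeOn tv

  TreeOn-∈ : ∀ {j} → 1 ≤ j → j ≤ n → 0 < bagT t j
  TreeOn-∈ {j} p q = subst (0 <_) (sym (trans (labels j) (count-[n]-in n j p q))) (s≤s z≤n)

  TreeOn-range : ∀ {j} → 0 < bagT t j → 1 ≤ j × j ≤ n
  TreeOn-range {j} p = count-[n]>0 n j (subst (0 <_) (labels j) p)

  TreeOn-≢top : ∀ {j} → 2 ≤ j → j ≢ top t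
  TreeOn-≢top p e with subst (2 ≤_) (trans e top≡1) p
  ... | s≤s ()

module ToBT (n : ℕ) (t : Tree) (tv : TreeOn n t) where
  open TreeOn tv

  non-root : ∀ {j} → 2 ≤ j → j ≤ n → 0 < bagT t j
  non-root 2≤j j≤n = TreeOn-∈ tv (≤-trans (s≤s z≤n) 2≤j) j≤n

  parent-range : ∀ j → 2 ≤ j → j ≤ n → 1 ≤ parentOf t j × parentOf t j < j
  parent-range j 2≤j j≤n with parentOf-< t j valid (non-root 2≤j j≤n) (TreeOn-≢top tv 2≤j)
  ... | lt , p∈t = proj₁ (TreeOn-range tv p∈t) , lt

  incTree : IncTree n
  incTree = record { parent = parentOf t ; parent-ok = parent-range }

  Child⇒child : ∀ {s j} → s ⊑ t → Child incTree (top s) j → j ∈ children s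
  Child⇒child q (2≤j , j≤n , e) = parentOf⇒child valid q (non-root 2≤j j≤n) (TreeOn-≢top tv 2≤j) e

  child⇒Child : ∀ {s c} → s ⊑ t → c ∈ children s → Child incTree (top s) c
  child⇒Child {s} q mem with child-top s (Increasing-⊑ q (proj₁ valid)) mem
  ... | c∈s , s<c = ≤-trans (s≤s (proj₁ (TreeOn-range tv (∈-⊑ q (top∈bagT s))))) s<c , proj₂ (TreeOn-range tv (∈-⊑ q c∈s)) ,
                    parentOf-child valid q mem

  toBT : BT n
  toBT = record { tree = incTree ; binary = at-most-two }
    where
    at-most-two : AtMostTwoChildren incTree
    at-most-two i j k l cj@(2≤j , j≤n , ej) ck cl with parent-exists t j valid (non-root 2≤j j≤n) (TreeOn-≢top tv 2≤j)
    ... | s , q , mem = pigeonhole (children s) (children-length s) (child-of-s cj) (child-of-s ck) (child-of-s cl)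
      where child-of-s : ∀ {x} → Child incTree i x → x ∈ children s
            child-of-s c = Child⇒child q (subst (λ p → Child incTree p _) (trans (sym ej) (parentOf-child valid q mem)) c)

  minPath : ∀ s → s ⊑ t → MinPathEnd incTree (top s) (minLeaf s)
  minPath (tip m) q = stop (λ j ch → no-child (Child⇒child q ch))
    where no-child : ∀ {j} → j ∉ []
          no-child ()
  minPath (one m c) q = step (child⇒Child q (here refl) , λ j ch → smallest (Child⇒child q ch)) (minPath c (⊑-trans (⊑-one ⊑-refl) q))
    where smallest : ∀ {j} → j ∈ top c ∷ [] → top c ≤ j
          smallest (here refl) = ≤-refl
  minPath (two m a b) q = step (child⇒Child q (here refl) , λ j ch → smallest (Child⇒child q ch)) (minPath a (⊑-trans (⊑-left ⊑-refl) q))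
    where smallest : ∀ {j} → j ∈ top a ∷ top b ∷ [] → top a ≤ j
          smallest (here refl) = ≤-refl
          smallest (there (here refl)) = <⇒≤ (two-sorted (Increasing-⊑ q (proj₁ valid)))

  minPath-root : MinPathEnd incTree 1 (minLeaf t)
  minPath-root = subst (λ z → MinPathEnd incTree z (minLeaf t)) top≡1 (minPath t ⊑-refl)

-- Rebuilding a tree from its parent function

-- insert j p t hangs a new leaf j below p; it does nothing when p is not a vertex or already has two children.
insert : ℕ → ℕ → Tree → Tree
insert j p (tip m) with m ≟ p
... | yes _ = one m (tip j)
... | no _ = tip m
insert j p (one m c) with m ≟ p
... | yes _ = two m c (tip j)
... | no _ = one m (insert j p c)
insert j p (two m a b) = two m (insert j p a) (insert j p b)

build : (ℕ → ℕ) → ℕ → Tree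
build P zero = tip 1
build P (suc zero) = tip 1
build P (suc (suc k)) = insert (suc (suc k)) (P (suc (suc k))) (build P (suc k))

-- restrict k t keeps the vertices up to k, which form a subtree since labels increase away from the root.
restrict : ℕ → Tree → Tree
restrict k (tip m) = tip m
restrict k (one m c) with top c ≤? k
... | yes _ = one m (restrict k c)
... | no _ = tip m
restrict k (two m a b) with top b ≤? k
... | yes _ = two m (restrict k a) (restrict k b)
... | no _ with top a ≤? k
...   | yes _ = one m (restrict k a)
...   | no _ = tip m

restrict-all : ∀ k t → (∀ j → 0 < bagT t j → j ≤ k) → restrict k t ≡ t
restrict-all k (tip m) h = refl
restrict-all k (one m c) h with top c ≤? k
... | yes _ = cong (one m) (restrict-all k c (λ j p → h j (∈-one {m} {c} p)))
... | no n = ⊥-elim (n (h (top c) (∈-one {m} {c} (top∈bagT c))))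
restrict-all k (two m a b) h with top b ≤? k
... | yes _ = cong₂ (two m) (restrict-all k a (λ j p → h j (∈-twoˡ {m} {a} {b} p))) (restrict-all k b (λ j p → h j (∈-twoʳ {m} {a} {b} p)))
... | no n = ⊥-elim (n (h (top b) (∈-twoʳ {m} {a} {b} (top∈bagT b))))

restrict-top : ∀ t → Increasing t → restrict (top t) t ≡ tip (top t)
restrict-top (tip m) _ = refl
restrict-top (one m c) (h , _) with top c ≤? m
... | yes le = ⊥-elim (<⇒≱ (h (top c) (top∈bagT c)) le)
... | no _ = refl
restrict-top (two m a b) (ha , hb , _) with top b ≤? m
... | yes le = ⊥-elim (<⇒≱ (hb (top b) (top∈bagT b)) le)
... | no _ with top a ≤? m
...   | yes le = ⊥-elim (<⇒≱ (ha (top a) (top∈bagT a)) le)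
...   | no _ = refl

≤∧≰⇒≡suc : ∀ {p k} → p ≤ suc k → ¬ p ≤ k → p ≡ suc k
≤∧≰⇒≡suc le n = ≤-antisym le (≰⇒> n)

∉-top : ∀ t {j} → bagT t j ≡ 0 → j ≡ top t → ⊥
∉-top t z e = <⇒≢ (top∈bagT t) (sym (subst (λ q → bagT t q ≡ 0) e z))

restrict-skip : ∀ k t → bagT t (suc k) ≡ 0 → restrict (suc k) t ≡ restrict k t
restrict-skip k (tip m) z = refl
restrict-skip k (one m c) z with top c ≤? suc k | top c ≤? k
... | yes _ | yes _ = cong (one m) (restrict-skip k c (m+n≡0⇒n≡0 (δ (suc k) m) z))
... | yes le | no n = ⊥-elim (∉-top c (m+n≡0⇒n≡0 (δ (suc k) m) z) (sym (≤∧≰⇒≡suc le n)))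
... | no n | yes le = ⊥-elim (n (≤-trans le (n≤1+n k)))
... | no _ | no _ = refl
restrict-skip k (two m a b) z with trans (sym (bagT-two m a b (suc k))) z
... | z' with top b ≤? suc k | top b ≤? k
...   | yes _ | yes _ = cong₂ (two m) (restrict-skip k a (m+n≡0⇒m≡0 _ (m+n≡0⇒n≡0 (δ (suc k) m) z'))) (restrict-skip k b (m+n≡0⇒n≡0 (bagT a (suc k)) (m+n≡0⇒n≡0 (δ (suc k) m) z')))
...   | yes le | no n = ⊥-elim (∉-top b (m+n≡0⇒n≡0 (bagT a (suc k)) (m+n≡0⇒n≡0 (δ (suc k) m) z')) (sym (≤∧≰⇒≡suc le n)))
...   | no n | yes le = ⊥-elim (n (≤-trans le (n≤1+n k)))
...   | no _ | no _ with top a ≤? suc k | top a ≤? k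
...     | yes _ | yes _ = cong (one m) (restrict-skip k a (m+n≡0⇒m≡0 _ (m+n≡0⇒n≡0 (δ (suc k) m) z')))
...     | yes le | no n = ⊥-elim (∉-top a (m+n≡0⇒m≡0 _ (m+n≡0⇒n≡0 (δ (suc k) m) z')) (sym (≤∧≰⇒≡suc le n)))
...     | no n | yes le = ⊥-elim (n (≤-trans le (n≤1+n k)))
...     | no _ | no _ = refl

insert-skip : ∀ j p t → bagT t p ≡ 0 → insert j p t ≡ t
insert-skip j p (tip m) z with m ≟ p
... | yes refl = ⊥-elim (∉-top (tip m) z refl)
... | no _ = refl
insert-skip j p (one m c) z with m ≟ p
... | yes refl = ⊥-elim (∉-top (one m c) z refl)
... | no _ = cong (one m) (insert-skip j p c (m+n≡0⇒n≡0 (δ p m) z))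
insert-skip j p (two m a b) z with trans (sym (bagT-two m a b p)) z
... | z' = cong₂ (two m) (insert-skip j p a (m+n≡0⇒m≡0 _ (m+n≡0⇒n≡0 (δ p m) z'))) (insert-skip j p b (m+n≡0⇒n≡0 (bagT a p) (m+n≡0⇒n≡0 (δ p m) z')))

restrict-⊆ : ∀ k t j → bagT (restrict k t) j ≤ bagT t j
restrict-⊆ k (tip m) j = ≤-refl
restrict-⊆ k (one m c) j with top c ≤? k
... | yes _ = +-monoʳ-≤ (δ j m) (restrict-⊆ k c j)
... | no _ = +-monoʳ-≤ (δ j m) z≤n
restrict-⊆ k (two m a b) j with top b ≤? k
... | yes _ rewrite bagT-two m (restrict k a) (restrict k b) j | bagT-two m a b j = +-monoʳ-≤ (δ j m) (+-mono-≤ (restrict-⊆ k a j) (restrict-⊆ k b j))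
... | no _ with top a ≤? k
...   | yes _ rewrite bagT-two m a b j = +-monoʳ-≤ (δ j m) (≤-trans (restrict-⊆ k a j) (m≤m+n _ _))
...   | no _ = +-monoʳ-≤ (δ j m) z≤n

restrict-∉ : ∀ k t j → bagT t j ≡ 0 → bagT (restrict k t) j ≡ 0
restrict-∉ k t j z = n≤0⇒n≡0 (subst (bagT (restrict k t) j ≤_) z (restrict-⊆ k t j))

restrict-one-keep : ∀ k m c → top c ≤ k → restrict k (one m c) ≡ one m (restrict k c)
restrict-one-keep k m c le with top c ≤? k
... | yes _ = refl
... | no n = ⊥-elim (n le)

restrict-one-drop : ∀ k m c → ¬ top c ≤ k → restrict k (one m c) ≡ tip m
restrict-one-drop k m c nle with top c ≤? k
... | yes le = ⊥-elim (nle le)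
... | no n = refl

restrict-two-keep : ∀ k m a b → top b ≤ k → restrict k (two m a b) ≡ two m (restrict k a) (restrict k b)
restrict-two-keep k m a b le with top b ≤? k
... | yes _ = refl
... | no n = ⊥-elim (n le)

restrict-two-keepˡ : ∀ k m a b → ¬ top b ≤ k → top a ≤ k → restrict k (two m a b) ≡ one m (restrict k a)
restrict-two-keepˡ k m a b nb la with top b ≤? k
... | yes lb = ⊥-elim (nb lb)
... | no _ with top a ≤? k
...   | yes _ = refl
...   | no n = ⊥-elim (n la)

restrict-two-drop : ∀ k m a b → ¬ top b ≤ k → ¬ top a ≤ k → restrict k (two m a b) ≡ tip m
restrict-two-drop k m a b nb na with top b ≤? k
... | yes lb = ⊥-elim (nb lb)
... | no _ with top a ≤? k
...   | yes la = ⊥-elim (na la)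
...   | no _ = refl

insert-tip : ∀ j m → insert j m (tip m) ≡ one m (tip j)
insert-tip j m with m ≟ m
... | yes _ = refl
... | no n = ⊥-elim (n refl)

insert-one : ∀ j m c → insert j m (one m c) ≡ two m c (tip j)
insert-one j m c with m ≟ m
... | yes _ = refl
... | no n = ⊥-elim (n refl)

insert-one-below : ∀ j p m c → m ≢ p → insert j p (one m c) ≡ one m (insert j p c)
insert-one-below j p m c ne with m ≟ p
... | yes e = ⊥-elim (ne e)
... | no _ = refl

parentOf-one-top : ∀ m c → parentOf (one m c) (top c) ≡ m
parentOf-one-top m c with top c ≟ top c
... | yes _ = refl
... | no n = ⊥-elim (n refl)

parentOf-one-other : ∀ m c k → k ≢ top c → parentOf (one m c) k ≡ parentOf c k
parentOf-one-other m c k ne with k ≟ top c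
... | yes e = ⊥-elim (ne e)
... | no _ = refl

parentOf-two-topˡ : ∀ m a b → parentOf (two m a b) (top a) ≡ m
parentOf-two-topˡ m a b with top a ≟ top a
... | yes _ = refl
... | no n = ⊥-elim (n refl)

parentOf-two-topʳ : ∀ m a b → top b ≢ top a → parentOf (two m a b) (top b) ≡ m
parentOf-two-topʳ m a b ne with top b ≟ top a
... | yes e = ⊥-elim (ne e)
... | no _ with top b ≟ top b
...   | yes _ = refl
...   | no n = ⊥-elim (n refl)

parentOf-twoˡ : ∀ m a b k → Valid (two m a b) → 0 < bagT a k → k ≢ top a → parentOf (two m a b) k ≡ parentOf a k
parentOf-twoˡ m a b k v p ne with k ≟ top a
... | yes e = ⊥-elim (ne e)
... | no _ with k ≟ top b
...   | yes e = ⊥-elim (Valid-two-disjoint {m} {a} {b} v p (top∈bagT b) e)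
...   | no _ rewrite parentOf-∉ b k (Valid-two-∉ʳ {m} {a} {b} v p) = +-identityʳ _

parentOf-twoʳ : ∀ m a b k → Valid (two m a b) → 0 < bagT b k → k ≢ top b → parentOf (two m a b) k ≡ parentOf b k
parentOf-twoʳ m a b k v p ne with k ≟ top a
... | yes e = ⊥-elim (Valid-two-disjoint {m} {a} {b} v (top∈bagT a) p (sym e))
... | no _ with k ≟ top b
...   | yes e = ⊥-elim (ne e)
...   | no _ rewrite parentOf-∉ a k (Valid-two-∉ˡ {m} {a} {b} v p) = refl

RestrictStep : Tree → ℕ → Set
RestrictStep t k = 0 < bagT t (suc k) → suc k ≢ top t → restrict (suc k) t ≡ insert (suc k) (parentOf t (suc k)) (restrict k t)

restrict-step-one : ∀ m c k → Valid (one m c) → RestrictStep c k → RestrictStep (one m c) k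
restrict-step-one m c k v ih p ne with top c ≟ suc k
... | yes c≡k+1 = begin
  restrict (suc k) (one m c)                             ≡⟨ restrict-one-keep (suc k) m c (≤-reflexive c≡k+1) ⟩
  one m (restrict (suc k) c)                             ≡⟨ cong (λ z → one m (restrict z c)) (sym c≡k+1) ⟩
  one m (restrict (top c) c)                             ≡⟨ cong (one m) (restrict-top c (proj₂ (proj₁ v))) ⟩
  one m (tip (top c))                                    ≡⟨ cong (λ z → one m (tip z)) c≡k+1 ⟩
  one m (tip (suc k))                                    ≡⟨ insert-tip (suc k) m ⟨
  insert (suc k) m (tip m)                               ≡⟨ cong₂ (insert (suc k)) parent≡m (restrict-one-drop k m c (λ le → <-irrefl c≡k+1 (s≤s le))) ⟨
  insert (suc k) (parentOf (one m c) (suc k)) (restrict k (one m c)) ∎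
  where open ≡-Reasoning
        parent≡m = trans (cong (parentOf (one m c)) (sym c≡k+1)) (parentOf-one-top m c)
... | no c≢k+1 = begin
  restrict (suc k) (one m c)                             ≡⟨ restrict-one-keep (suc k) m c (<⇒≤ c<k+1) ⟩
  one m (restrict (suc k) c)                             ≡⟨ cong (one m) (ih pc k+1≢c) ⟩
  one m (insert (suc k) (parentOf c (suc k)) (restrict k c)) ≡⟨ insert-one-below (suc k) (parentOf c (suc k)) m (restrict k c) m≢parent ⟨
  insert (suc k) (parentOf c (suc k)) (one m (restrict k c)) ≡⟨ cong₂ (insert (suc k)) (parentOf-one-other m c (suc k) k+1≢c) (restrict-one-keep k m c (≤-pred c<k+1)) ⟨
  insert (suc k) (parentOf (one m c) (suc k)) (restrict k (one m c)) ∎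
  where
  open ≡-Reasoning
  k+1≢c : suc k ≢ top c
  k+1≢c e = c≢k+1 (sym e)
  pc : 0 < bagT c (suc k)
  pc = subst (0 <_) (cong (_+ bagT c (suc k)) (δ-≢ ne)) p
  c<k+1 : top c < suc k
  c<k+1 = Increasing-top< c (proj₂ (proj₁ v)) (suc k) pc k+1≢c
  m≢parent : m ≢ parentOf c (suc k)
  m≢parent e = <-irrefl e (proj₁ (proj₁ v) (parentOf c (suc k)) (proj₂ (parentOf-< c (suc k) (Valid-one v) pc k+1≢c)))

restrict-step-left : ∀ m a b k → Valid (two m a b) → RestrictStep a k → 0 < bagT a (suc k) →
  restrict (suc k) (two m a b) ≡ insert (suc k) (parentOf (two m a b) (suc k)) (restrict k (two m a b))
restrict-step-left m a b k v ih pa with top a ≟ suc k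
... | yes e' =
  trans (restrict-two-keepˡ (suc k) m a b (λ le → <-irrefl refl (<-≤-trans (subst (_< top b) e' ltab) le)) (≤-reflexive e'))
    (trans (cong (one m) (trans (cong (λ z → restrict z a) (sym e')) (trans (restrict-top a (Increasing-twoˡ (proj₁ v))) (cong tip e'))))
    (sym (trans (cong₂ (insert (suc k)) (trans (cong (parentOf (two m a b)) (sym e')) (parentOf-two-topˡ m a b))
                  (restrict-two-drop k m a b (λ le → <-irrefl refl (<-≤-trans (subst (_< top b) e' ltab) (≤-trans le (n≤1+n k))))
                                    (λ le → <-irrefl e' (s≤s le))))
           (insert-tip (suc k) m))))
  where ltab = two-sorted (proj₁ v)
... | no ne'' with <-cmp (top b) (suc k)
...   | tri≈ _ e _ = ⊥-elim (Valid-two-disjoint {m} {a} {b} v pa (top∈bagT b) (sym e))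
...   | tri< lb' _ _ =
  trans (restrict-two-keep (suc k) m a b (<⇒≤ lb'))
    (sym (trans (cong₂ (insert (suc k)) (parentOf-twoˡ m a b (suc k) v pa ne') (restrict-two-keep k m a b lbk))
      (cong₂ (two m) (sym (ih pa ne'))
         (trans (insert-skip (suc k) (parentOf a (suc k)) (restrict k b) (restrict-∉ k b _ (Valid-two-∉ʳ {m} {a} {b} v (proj₂ (parentOf-< a (suc k) (Valid-twoˡ v) pa ne')))))
                (sym (restrict-skip k b (Valid-two-∉ʳ {m} {a} {b} v pa)))))))
  where ne' : suc k ≢ top a
        ne' e = ne'' (sym e)
        lbk : top b ≤ k
        lbk = ≤-pred lb'
...   | tri> _ _ gt' =
  trans (restrict-two-keepˡ (suc k) m a b nb (<⇒≤ gta))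
    (sym (trans (cong₂ (insert (suc k)) (parentOf-twoˡ m a b (suc k) v pa ne') (restrict-two-keepˡ k m a b (λ le → nb (≤-trans le (n≤1+n k))) (≤-pred gta)))
      (trans (insert-one-below (suc k) (parentOf a (suc k)) m (restrict k a) mne) (cong (one m) (sym (ih pa ne'))))))
  where nb : ¬ top b ≤ suc k
        nb le = <⇒≱ gt' le
        ne' : suc k ≢ top a
        ne' e = ne'' (sym e)
        gta : top a < suc k
        gta = Increasing-top< a (Increasing-twoˡ (proj₁ v)) (suc k) pa ne'
        mne : m ≢ parentOf a (suc k)
        mne e = <-irrefl e (proj₁ (proj₁ v) (parentOf a (suc k)) (proj₂ (parentOf-< a (suc k) (Valid-twoˡ v) pa ne')))

restrict-step-right : ∀ m a b k → Valid (two m a b) → RestrictStep b k → 0 < bagT b (suc k) →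
  restrict (suc k) (two m a b) ≡ insert (suc k) (parentOf (two m a b) (suc k)) (restrict k (two m a b))
restrict-step-right m a b k v ih pb with top b ≟ suc k
... | yes e' =
  trans (restrict-two-keep (suc k) m a b (≤-reflexive e'))
    (trans (cong₂ (two m) (restrict-skip k a za) (trans (cong (λ z → restrict z b) (sym e')) (trans (restrict-top b (Increasing-twoʳ (proj₁ v))) (cong tip e'))))
    (sym (trans (cong₂ (insert (suc k)) (trans (cong (parentOf (two m a b)) (sym e')) (parentOf-two-topʳ m a b (λ e → <-irrefl (sym e) ltab)))
                   (restrict-two-keepˡ k m a b (λ le → <-irrefl e' (s≤s le)) (≤-pred (subst (top a <_) e' ltab))))
           (insert-one (suc k) m (restrict k a)))))
  where ltab = two-sorted (proj₁ v)
        za : bagT a (suc k) ≡ 0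
        za = Valid-two-∉ˡ {m} {a} {b} v pb
... | no ne'' =
  trans (restrict-two-keep (suc k) m a b (<⇒≤ gtb))
    (sym (trans (cong₂ (insert (suc k)) (parentOf-twoʳ m a b (suc k) v pb ne') (restrict-two-keep k m a b (≤-pred gtb)))
      (cong₂ (two m)
         (trans (insert-skip (suc k) (parentOf b (suc k)) (restrict k a) (restrict-∉ k a _ (Valid-two-∉ˡ {m} {a} {b} v (proj₂ (parentOf-< b (suc k) (Valid-twoʳ v) pb ne')))))
                (sym (restrict-skip k a (Valid-two-∉ˡ {m} {a} {b} v pb))))
         (sym (ih pb ne')))))
  where ne' : suc k ≢ top b
        ne' e = ne'' (sym e)
        gtb : top b < suc k
        gtb = Increasing-top< b (Increasing-twoʳ (proj₁ v)) (suc k) pb ne'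

restrict-step : ∀ t k → Valid t → RestrictStep t k
restrict-step (tip m) k v p ne = ⊥-elim (ne (δ>0⇒≡ (subst (0 <_) (+-identityʳ _) p)))
restrict-step (one m c) k v = restrict-step-one m c k v (restrict-step c k (Valid-one v))
restrict-step (two m a b) k v p ne with +-pos-split (bagT a (suc k)) (bagT b (suc k)) (subst (0 <_) (trans (bagT-two m a b (suc k)) (cong (_+ (bagT a (suc k) + bagT b (suc k))) (δ-≢ ne))) p)
... | inj₁ pa = restrict-step-left m a b k v (restrict-step a k (Valid-twoˡ v)) pa
... | inj₂ pb = restrict-step-right m a b k v (restrict-step b k (Valid-twoʳ v)) pb

build-restrict : ∀ n t → TreeOn n t → ∀ k → 1 ≤ k → k ≤ n → build (parentOf t) k ≡ restrict k t
build-restrict n t on (suc zero) _ _ = begin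
  tip 1                    ≡⟨ cong tip (TreeOn.top≡1 on) ⟨
  tip (top t)              ≡⟨ restrict-top t (proj₁ (TreeOn.valid on)) ⟨
  restrict (top t) t       ≡⟨ cong (λ z → restrict z t) (TreeOn.top≡1 on) ⟩
  restrict 1 t             ∎
  where open ≡-Reasoning
build-restrict n t on (suc (suc k)) _ k+2≤n = begin
  insert (suc (suc k)) (parentOf t (suc (suc k))) (build (parentOf t) (suc k)) ≡⟨ cong (insert (suc (suc k)) (parentOf t (suc (suc k)))) (build-restrict n t on (suc k) (s≤s z≤n) (≤-trans (n≤1+n _) k+2≤n)) ⟩
  insert (suc (suc k)) (parentOf t (suc (suc k))) (restrict (suc k) t)         ≡⟨ restrict-step t (suc k) (TreeOn.valid on) k+2∈t k+2≢1 ⟨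
  restrict (suc (suc k)) t                                                     ∎
  where
  open ≡-Reasoning
  k+2∈t = TreeOn-∈ on (s≤s z≤n) k+2≤n
  k+2≢1 = TreeOn-≢top on (s≤s (s≤s z≤n))

build-cong : ∀ n P Q → (∀ j → 2 ≤ j → j ≤ n → P j ≡ Q j) → ∀ k → k ≤ n → build P k ≡ build Q k
build-cong n P Q e zero _ = refl
build-cong n P Q e (suc zero) _ = refl
build-cong n P Q e (suc (suc k)) le = cong₂ (insert (suc (suc k))) (e (suc (suc k)) (s≤s (s≤s z≤n)) le) (build-cong n P Q e (suc k) (≤-trans (n≤1+n _) le))

build-parentOf : ∀ n t → 1 ≤ n → TreeOn n t → build (parentOf t) n ≡ t
build-parentOf n t 1≤n on = trans (build-restrict n t on n 1≤n ≤-refl) (restrict-all n t (λ j p → proj₂ (TreeOn-range on p)))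

parentOf-injective : ∀ n t t′ → 1 ≤ n → TreeOn n t → TreeOn n t′ → (∀ j → 2 ≤ j → j ≤ n → parentOf t j ≡ parentOf t′ j) → t ≡ t′
parentOf-injective n t t′ 1≤n on on′ same = begin
  t                        ≡⟨ build-parentOf n t 1≤n on ⟨
  build (parentOf t) n     ≡⟨ build-cong n (parentOf t) (parentOf t′) same n ≤-refl ⟩
  build (parentOf t′) n    ≡⟨ build-parentOf n t′ 1≤n on′ ⟩
  t′                       ∎
  where open ≡-Reasoning

node-with-top : ∀ t p → 0 < bagT t p → Σ Tree λ s → s ⊑ t × top s ≡ p
node-with-top (tip m) p h = tip m , ⊑-refl , sym (δ>0⇒≡ (subst (0 <_) (+-identityʳ _) h))
node-with-top (one m c) p h with p ≟ m
... | yes refl = one m c , ⊑-refl , refl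
... | no ne with node-with-top c p h
...   | s , q , e = s , ⊑-one q , e
node-with-top (two m a b) p h with p ≟ m
... | yes refl = two m a b , ⊑-refl , refl
... | no ne with +-pos-split (bagT a p) (bagT b p) (subst (0 <_) (count-++ (vertices a) (vertices b) p) h)
...   | inj₁ pa with node-with-top a p pa
...     | s , q , e = s , ⊑-left q , e
node-with-top (two m a b) p h | no ne | inj₂ pb with node-with-top b p pb
...     | s , q , e = s , ⊑-right q , e

NotFull : Tree → Set
NotFull (two _ _ _) = ⊥
NotFull _ = ⊤

parentOf-two-other : ∀ m a b i → i ≢ top a → i ≢ top b → parentOf (two m a b) i ≡ parentOf a i + parentOf b i
parentOf-two-other m a b i na nb with i ≟ top a
... | yes e = ⊥-elim (na e)
... | no _ with i ≟ top b
...   | yes e = ⊥-elim (nb e)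
...   | no _ = refl

top-insert : ∀ j p t → top (insert j p t) ≡ top t
top-insert j p (tip m) with m ≟ p
... | yes _ = refl
... | no _ = refl
top-insert j p (one m c) with m ≟ p
... | yes _ = refl
... | no _ = refl
top-insert j p (two m a b) = refl

module Insert (j p : ℕ) where
  p∉ʳ : ∀ {s m a b} → Valid (two m a b) → s ⊑ a → top s ≡ p → bagT b p ≡ 0
  p∉ʳ {s} {m} {a} {b} v q e = Valid-two-∉ʳ {m} {a} {b} v (subst (λ w → 0 < bagT a w) e (∈-⊑ q (top∈bagT s)))

  p∉ˡ : ∀ {s m a b} → Valid (two m a b) → s ⊑ b → top s ≡ p → bagT a p ≡ 0
  p∉ˡ {s} {m} {a} {b} v q e = Valid-two-∉ˡ {m} {a} {b} v (subst (λ w → 0 < bagT b w) e (∈-⊑ q (top∈bagT s)))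

  m≢p : ∀ {s m c} → Valid (one m c) → s ⊑ c → top s ≡ p → m ≢ p
  m≢p v q e m≡p = <⇒≢ (top<-one (proj₁ v) q) (trans m≡p (sym e))

  bag-insert : ∀ {s} t → Valid t → s ⊑ t → top s ≡ p → NotFull s → bagT (insert j p t) ≗ bagT t ⊕ ⟦ j ⟧
  bag-insert (tip m) v ⊑-refl refl nb z rewrite insert-tip j m = shuffle (δ z m) (δ z j)
    where shuffle : ∀ x y → x + (y + 0) ≡ (x + 0) + y
          shuffle = solve-∀
  bag-insert (one m c) v ⊑-refl refl nb z rewrite insert-one j m c = trans (bagT-two m c (tip j) z) (shuffle (δ z m) (bagT c z) (δ z j))
    where shuffle : ∀ x y w → x + (y + (w + 0)) ≡ (x + y) + w
          shuffle = solve-∀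
  bag-insert (one m c) v (⊑-one q) e nb z rewrite insert-one-below j p m c (m≢p v q e) =
    trans (cong (δ z m +_) (bag-insert c (Valid-one v) q e nb z)) (sym (+-assoc (δ z m) (bagT c z) (δ z j)))
  bag-insert (two m a b) v (⊑-left q) e nb z rewrite insert-skip j p b (p∉ʳ v q e) = begin
    bagT (two m (insert j p a) b) z             ≡⟨ bagT-two m (insert j p a) b z ⟩
    δ z m + (bagT (insert j p a) z + bagT b z)  ≡⟨ cong (λ w → δ z m + (w + bagT b z)) (bag-insert a (Valid-twoˡ v) q e nb z) ⟩
    δ z m + ((bagT a z + δ z j) + bagT b z)     ≡⟨ shuffle (δ z m) (bagT a z) (δ z j) (bagT b z) ⟩
    (δ z m + (bagT a z + bagT b z)) + δ z j     ≡⟨ cong (_+ δ z j) (bagT-two m a b z) ⟨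
    bagT (two m a b) z + δ z j                  ∎
    where open ≡-Reasoning
          shuffle : ∀ x y w u → x + ((y + w) + u) ≡ (x + (y + u)) + w
          shuffle = solve-∀
  bag-insert (two m a b) v (⊑-right q) e nb z rewrite insert-skip j p a (p∉ˡ v q e) = begin
    bagT (two m a (insert j p b)) z             ≡⟨ bagT-two m a (insert j p b) z ⟩
    δ z m + (bagT a z + bagT (insert j p b) z)  ≡⟨ cong (λ w → δ z m + (bagT a z + w)) (bag-insert b (Valid-twoʳ v) q e nb z) ⟩
    δ z m + (bagT a z + (bagT b z + δ z j))     ≡⟨ shuffle (δ z m) (bagT a z) (bagT b z) (δ z j) ⟩
    (δ z m + (bagT a z + bagT b z)) + δ z j     ≡⟨ cong (_+ δ z j) (bagT-two m a b z) ⟨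
    bagT (two m a b) z + δ z j                  ∎
    where open ≡-Reasoning
          shuffle : ∀ x y u w → x + (y + (u + w)) ≡ (x + (y + u)) + w
          shuffle = solve-∀
  bag-insert (two m a b) v ⊑-refl e ()

  Every-δ : ∀ {P : ℕ → Set} → P j → Every P (λ z → δ z j)
  Every-δ pj z q rewrite δ>0⇒≡ {z} {j} q = pj

  Increasing-insert : ∀ {s} t → Valid t → s ⊑ t → top s ≡ p → NotFull s → Every (_< j) (bagT t) → Increasing (insert j p t)
  Increasing-insert {.(tip m)} (tip m) v ⊑-refl refl nb h rewrite insert-tip j m = Every-δ+ {f = λ _ → 0} (h m (top∈bagT (tip m))) (λ _ ()) , tt
  Increasing-insert {.(one m c)} (one m c) v ⊑-refl refl nb h rewrite insert-one j m c =
    proj₁ (proj₁ v) , Every-δ+ {f = λ _ → 0} (h m (top∈bagT (one m c))) (λ _ ()) , h (top c) (∈-one {m} {c} (top∈bagT c)) , proj₂ (proj₁ v) , tt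
  Increasing-insert {s} (one m c) v (⊑-one q) e nb h rewrite insert-one-below j p m c (m≢p v q e) =
    Every-≗ (bag-insert c (Valid-one v) q e nb) (Every-⊕ (proj₁ (proj₁ v)) (Every-δ (h m (top∈bagT (one m c))))) ,
    Increasing-insert c (Valid-one v) q e nb (λ z p' → h z (∈-one {m} {c} p'))
  Increasing-insert {s} (two m a b) v (⊑-left q) e nb h rewrite insert-skip j p b (p∉ʳ v q e) =
    Every-≗ (bag-insert a (Valid-twoˡ v) q e nb) (Every-⊕ (proj₁ (proj₁ v)) (Every-δ (h m (top∈bagT (two m a b))))) ,
    proj₁ (proj₂ (proj₁ v)) ,
    subst (_< top b) (sym (top-insert j p a)) (two-sorted (proj₁ v)) ,
    Increasing-insert a (Valid-twoˡ v) q e nb (λ z p' → h z (∈-twoˡ {m} {a} {b} p')) ,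
    Increasing-twoʳ (proj₁ v)
  Increasing-insert {s} (two m a b) v (⊑-right q) e nb h rewrite insert-skip j p a (p∉ˡ v q e) =
    proj₁ (proj₁ v) ,
    Every-≗ (bag-insert b (Valid-twoʳ v) q e nb) (Every-⊕ (proj₁ (proj₂ (proj₁ v))) (Every-δ (h m (top∈bagT (two m a b))))) ,
    subst (top a <_) (sym (top-insert j p b)) (two-sorted (proj₁ v)) ,
    Increasing-twoˡ (proj₁ v) ,
    Increasing-insert b (Valid-twoʳ v) q e nb (λ z p' → h z (∈-twoʳ {m} {a} {b} p'))
  Increasing-insert {.(two m a b)} (two m a b) v ⊑-refl e () h

  parentOf-insert : ∀ {s} t → Valid t → s ⊑ t → top s ≡ p → NotFull s → ∀ i → i ≢ j → parentOf (insert j p t) i ≡ parentOf t i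
  parentOf-insert {.(tip m)} (tip m) v ⊑-refl refl nb i ne rewrite insert-tip j m = parentOf-one-other m (tip j) i ne
  parentOf-insert {.(one m c)} (one m c) v ⊑-refl refl nb i ne rewrite insert-one j m c with top c ≟ i
  ... | yes refl = trans (parentOf-two-topˡ m c (tip j)) (sym (parentOf-one-top m c))
  ... | no ne' = trans (parentOf-two-other m c (tip j) i (λ e → ne' (sym e)) ne) (trans (+-identityʳ _) (sym (parentOf-one-other m c i (λ e → ne' (sym e)))))
  parentOf-insert {s} (one m c) v (⊑-one q) e nb i ne rewrite insert-one-below j p m c (m≢p v q e) with top c ≟ i
  ... | yes refl = trans (cong (parentOf (one m (insert j p c))) (sym (top-insert j p c))) (trans (parentOf-one-top m (insert j p c)) (sym (parentOf-one-top m c)))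
  ... | no ne' = trans (parentOf-one-other m (insert j p c) i (λ e' → ne' (sym (trans e' (top-insert j p c)))))
                   (trans (parentOf-insert c (Valid-one v) q e nb i ne) (sym (parentOf-one-other m c i (λ e' → ne' (sym e')))))
  parentOf-insert {s} (two m a b) v (⊑-left q) e nb i ne rewrite insert-skip j p b (p∉ʳ v q e) with top a ≟ i
  ... | yes refl = trans (cong (parentOf (two m (insert j p a) b)) (sym (top-insert j p a))) (trans (parentOf-two-topˡ m (insert j p a) b) (sym (parentOf-two-topˡ m a b)))
  ... | no na with top b ≟ i
  ...   | yes refl = trans (parentOf-two-topʳ m (insert j p a) b (λ e' → <-irrefl (sym (trans e' (top-insert j p a))) (two-sorted (proj₁ v))))
                       (sym (parentOf-two-topʳ m a b (λ e' → <-irrefl (sym e') (two-sorted (proj₁ v)))))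
  ...   | no nb' = trans (parentOf-two-other m (insert j p a) b i (λ e' → na (sym (trans e' (top-insert j p a)))) (λ e' → nb' (sym e')))
                    (trans (cong (_+ parentOf b i) (parentOf-insert a (Valid-twoˡ v) q e nb i ne)) (sym (parentOf-two-other m a b i (λ e' → na (sym e')) (λ e' → nb' (sym e')))))
  parentOf-insert {s} (two m a b) v (⊑-right q) e nb i ne rewrite insert-skip j p a (p∉ˡ v q e) with top a ≟ i
  ... | yes refl = trans (parentOf-two-topˡ m a (insert j p b)) (sym (parentOf-two-topˡ m a b))
  ... | no na with top b ≟ i
  ...   | yes refl = trans (cong (parentOf (two m a (insert j p b))) (sym (top-insert j p b)))
                       (trans (parentOf-two-topʳ m a (insert j p b) (λ e' → <-irrefl (trans (sym e') (top-insert j p b)) (two-sorted (proj₁ v))))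
                       (sym (parentOf-two-topʳ m a b (λ e' → <-irrefl (sym e') (two-sorted (proj₁ v))))))
  ...   | no nb' = trans (parentOf-two-other m a (insert j p b) i (λ e' → na (sym e')) (λ e' → nb' (sym (trans e' (top-insert j p b)))))
                    (trans (cong (parentOf a i +_) (parentOf-insert b (Valid-twoʳ v) q e nb i ne)) (sym (parentOf-two-other m a b i (λ e' → na (sym e')) (λ e' → nb' (sym e')))))
  parentOf-insert {.(two m a b)} (two m a b) v ⊑-refl e () i ne

  ∉⇒≢top : ∀ {x t} → x ⊑ t → bagT t j ≡ 0 → j ≢ top x
  ∉⇒≢top {x} {t} q z e = <⇒≢ (∈-⊑ q (top∈bagT x)) (sym (subst (λ w → bagT t w ≡ 0) e z))

  parentOf-insert-new : ∀ {s} t → Valid t → s ⊑ t → top s ≡ p → NotFull s → bagT t j ≡ 0 → parentOf (insert j p t) j ≡ p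
  parentOf-insert-new {.(tip m)} (tip m) v ⊑-refl refl nb z rewrite insert-tip j m = parentOf-one-top m (tip j)
  parentOf-insert-new {.(one m c)} (one m c) v ⊑-refl refl nb z rewrite insert-one j m c =
    parentOf-two-topʳ m c (tip j) (∉⇒≢top {c} {one m c} (⊑-one ⊑-refl) z)
  parentOf-insert-new {s} (one m c) v (⊑-one q) e nb z rewrite insert-one-below j p m c (m≢p v q e) =
    trans (parentOf-one-other m (insert j p c) j (λ e' → ∉⇒≢top {c} {one m c} (⊑-one ⊑-refl) z (trans e' (top-insert j p c))))
      (parentOf-insert-new c (Valid-one v) q e nb (m+n≡0⇒n≡0 (δ j m) z))
  parentOf-insert-new {s} (two m a b) v (⊑-left q) e nb z rewrite insert-skip j p b (p∉ʳ v q e) =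
    trans (parentOf-two-other m (insert j p a) b j (λ e' → ∉⇒≢top {a} {two m a b} (⊑-left ⊑-refl) z (trans e' (top-insert j p a))) (∉⇒≢top {b} {two m a b} (⊑-right ⊑-refl) z))
      (trans (cong₂ _+_ (parentOf-insert-new a (Valid-twoˡ v) q e nb za) (parentOf-∉ b j zb)) (+-identityʳ p))
    where z' = trans (sym (bagT-two m a b j)) z
          za = m+n≡0⇒m≡0 _ (m+n≡0⇒n≡0 (δ j m) z')
          zb = m+n≡0⇒n≡0 (bagT a j) (m+n≡0⇒n≡0 (δ j m) z')
  parentOf-insert-new {s} (two m a b) v (⊑-right q) e nb z rewrite insert-skip j p a (p∉ˡ v q e) =
    trans (parentOf-two-other m a (insert j p b) j (∉⇒≢top {a} {two m a b} (⊑-left ⊑-refl) z) (λ e' → ∉⇒≢top {b} {two m a b} (⊑-right ⊑-refl) z (trans e' (top-insert j p b))))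
      (cong₂ _+_ (parentOf-∉ a j za) (parentOf-insert-new b (Valid-twoʳ v) q e nb zb))
    where z' = trans (sym (bagT-two m a b j)) z
          za = m+n≡0⇒m≡0 _ (m+n≡0⇒n≡0 (δ j m) z')
          zb = m+n≡0⇒n≡0 (bagT a j) (m+n≡0⇒n≡0 (δ j m) z')
  parentOf-insert-new {.(two m a b)} (two m a b) v ⊑-refl e () z

SameParents : ∀ {n} → BT n → ℕ → Tree → Set
SameParents T k t = ∀ j → 2 ≤ j → j ≤ k → parentOf t j ≡ parent (tree T) j

-- The vertex where k+1 hangs in T has at most one child smaller than k+1, so it is not full in the tree on [k].
parent-not-full : ∀ {n} (T : BT n) k t → 1 ≤ k → suc k ≤ n → TreeOn k t → SameParents T k t →
  ∀ s → s ⊑ t → top s ≡ parent (tree T) (suc k) → 1 ≤ parent (tree T) (suc k) → NotFull s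
parent-not-full T k t 1≤k k<n on same (tip _) q e p≥1 = tt
parent-not-full T k t 1≤k k<n on same (one _ _) q e p≥1 = tt
parent-not-full T k t 1≤k k<n on same (two m a b) q e p≥1 =
  impossible (binary T _ (top a) (top b) (suc k) (child-in-T (here refl)) (child-in-T (there (here refl))) (s≤s 1≤k , k<n , refl))
  where
  inc = Increasing-⊑ q (proj₁ (TreeOn.valid on))
  child-in-T : ∀ {c} → c ∈ children (two m a b) → Child (tree T) (parent (tree T) (suc k)) c
  child-in-T {c} mem with child-top (two m a b) inc mem
  ... | c∈s , m<c = 2≤c , ≤-trans c≤k (≤-trans (n≤1+n k) k<n) , trans (sym (same c 2≤c c≤k)) (trans (parentOf-child (TreeOn.valid on) q mem) e)
    where c≤k = proj₂ (TreeOn-range on (∈-⊑ q c∈s))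
          2≤c = ≤-trans (s≤s (subst (1 ≤_) (sym e) p≥1)) m<c
  a≤k = proj₂ (TreeOn-range on (∈-⊑ q (∈-twoˡ {m} {a} {b} (top∈bagT a))))
  b≤k = proj₂ (TreeOn-range on (∈-⊑ q (∈-twoʳ {m} {a} {b} (top∈bagT b))))
  impossible : top a ≡ top b ⊎ top a ≡ suc k ⊎ top b ≡ suc k → ⊥
  impossible (inj₁ a≡b) = <-irrefl a≡b (two-sorted inc)
  impossible (inj₂ (inj₁ a≡k+1)) = <-irrefl refl (<-≤-trans (s≤s a≤k) (≤-reflexive (sym a≡k+1)))
  impossible (inj₂ (inj₂ b≡k+1)) = <-irrefl refl (<-≤-trans (s≤s b≤k) (≤-reflexive (sym b≡k+1)))

build-step : ∀ {n} (T : BT n) k t → 1 ≤ k → suc k ≤ n → TreeOn k t → SameParents T k t →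
  TreeOn (suc k) (insert (suc k) (parent (tree T) (suc k)) t) × SameParents T (suc k) (insert (suc k) (parent (tree T) (suc k)) t)
build-step T k t 1≤k k<n on same with parent-ok (tree T) (suc k) (s≤s 1≤k) k<n
... | p≥1 , p≤k with node-with-top t (parent (tree T) (suc k)) (TreeOn-∈ on p≥1 (≤-pred p≤k))
... | s , q , e =
  treeOn (Insert.Increasing-insert K P t v q e room below-K , Distinct-≗ labels′ (Distinct-[n] K)) (trans (top-insert K P t) (TreeOn.top≡1 on)) labels′ ,
  same′
  where
  K = suc k
  P = parent (tree T) (suc k)
  v = TreeOn.valid on
  room = parent-not-full T k t 1≤k k<n on same s q e p≥1
  K∉t : bagT t K ≡ 0
  K∉t = trans (TreeOn.labels on K) (count-[n]-out k K (inj₂ ≤-refl))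
  below-K : Every (_< K) (bagT t)
  below-K z pz = s≤s (proj₂ (TreeOn-range on pz))
  labels′ : bagT (insert K P t) ≗ count [ K ]
  labels′ z = trans (Insert.bag-insert K P t v q e room z) (trans (cong (_+ δ z K) (TreeOn.labels on z))
                (sym (trans (count-[n]-suc k z) (cong (count [ k ] z +_) (+-identityʳ _)))))
  same′ : SameParents T K (insert K P t)
  same′ j 2≤j j≤K with j ≟ K
  ... | yes refl = Insert.parentOf-insert-new K P t v q e room K∉t
  ... | no j≢K = trans (Insert.parentOf-insert K P t v q e room j j≢K) (same j 2≤j (≤-pred (≤∧≢⇒< j≤K j≢K)))

build-ok : ∀ {n} (T : BT n) k → 1 ≤ k → k ≤ n → TreeOn k (build (parent (tree T)) k) × SameParents T k (build (parent (tree T)) k)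
build-ok T (suc zero) _ _ =
  treeOn (tt , (λ z → subst (_≤ 1) (sym (+-identityʳ (δ z 1))) (δ≤1 z 1))) refl (λ z → sym (count-[n]-suc 0 z)) ,
  λ { j (s≤s (s≤s _)) (s≤s ()) }
build-ok T (suc (suc k)) _ k+2≤n with build-ok T (suc k) (s≤s z≤n) (≤-trans (n≤1+n _) k+2≤n)
... | on , same = build-step T (suc k) (build (parent (tree T)) (suc k)) (s≤s z≤n) k+2≤n on same

Distinct-word : ∀ {n} (π : DU n) → Distinct (count (word π))
Distinct-word {n} π = Distinct-≗ (↭⇒count≗ (isPerm π)) (Distinct-[n] n)

1∈[n] : ∀ {n} → 1 ≤ n → 0 < count [ n ] 1
1∈[n] {n} 1≤n = subst (0 <_) (sym (count-[n]-in n 1 ≤-refl 1≤n)) (s≤s z≤n)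

Heap-root≡1 : ∀ {n} x → Heap x → IsNode x → bag x ≗ count [ n ] → 1 ≤ n → root x ≡ 1
Heap-root≡1 {n} (node l m r) hx _ bags 1≤n =
  ≤-antisym (Heap-root≤ (node l m r) hx 1 (subst (0 <_) (sym (bags 1)) (1∈[n] 1≤n)))
            (proj₁ (count-[n]>0 n m (subst (0 <_) (bags m) (root∈bag l m r))))

module Bijection (n : ℕ) (1≤n : 1 ≤ n) where

  reading : (π : DU n) → TreeOf (word π)
  reading π = treeOf _ (word π) ≤-refl (downUp π) (Distinct-word π)

  heapOf : DU n → BinTree
  heapOf π = TreeOf.heap (reading π)

  inorder-heapOf : ∀ π → inorder (heapOf π) ≡ word π
  inorder-heapOf π = TreeOf.reads (reading π)

  Heap-heapOf : ∀ π → Heap (heapOf π)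
  Heap-heapOf π = TreeOf.ordered (reading π)

  bag-heapOf : ∀ π → bag (heapOf π) ≗ count [ n ]
  bag-heapOf π a = trans (cong (λ w → count w a) (inorder-heapOf π)) (↭⇒count≗ (isPerm π) a)

  IsNode-heapOf : ∀ π → IsNode (heapOf π)
  IsNode-heapOf π with heapOf π | bag-heapOf π
  ... | node l m r | _ = l , m , r , refl
  ... | ∅ | bags = ⊥-elim (<-irrefl (bags 1) (1∈[n] 1≤n))

  heapOf-cong : ∀ π σ → word π ≡ word σ → heapOf π ≡ heapOf σ
  heapOf-cong π σ e = inorder-injective _ _ (Heap-heapOf π) (Heap-heapOf σ)
                        (trans (inorder-heapOf π) (trans e (sym (inorder-heapOf σ))))

  treeOfDU : DU n → Tree
  treeOfDU π = decode (size (heapOf π)) (heapOf π)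

  decodes : ∀ π → Decodes (heapOf π) (treeOfDU π)
  decodes π = decode-ok _ (heapOf π) (TreeOf.alt (reading π)) (Heap-heapOf π) (Distinct-≗ (bag-heapOf π) (Distinct-[n] n)) (IsNode-heapOf π) ≤-refl

  treeOfDU-on : ∀ π → TreeOn n (treeOfDU π)
  treeOfDU-on π = record
    { valid = proj₁ (proj₂ (decodes π)) , Distinct-≗ bags (Distinct-[n] n)
    ; top≡1 = trans (Decodes-top (decodes π)) (Heap-root≡1 (heapOf π) (Heap-heapOf π) (IsNode-heapOf π) (bag-heapOf π) 1≤n)
    ; labels = bags
    }
    where bags : bagT (treeOfDU π) ≗ count [ n ]
          bags a = trans (Decodes-bag (decodes π) a) (bag-heapOf π a)

  Ψ : DU n → BT n
  Ψ π = ToBT.toBT n (treeOfDU π) (treeOfDU-on π)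

  Ψ-cong : (π σ : DU n) → word π ≡ word σ → Ψ π ≈B Ψ σ
  Ψ-cong π σ e j _ _ = cong (λ x → parentOf (decode (size x) x) j) (heapOf-cong π σ e)

  Ψ-injective : (π σ : DU n) → Ψ π ≈B Ψ σ → word π ≡ word σ
  Ψ-injective π σ same = begin
    word π                            ≡⟨ inorder-heapOf π ⟨
    inorder (heapOf π)                ≡⟨ cong inorder (proj₁ (decodes π)) ⟨
    inorder (encode (treeOfDU π))     ≡⟨ cong (λ z → inorder (encode z)) (parentOf-injective n _ _ 1≤n (treeOfDU-on π) (treeOfDU-on σ) same) ⟩
    inorder (encode (treeOfDU σ))     ≡⟨ cong inorder (proj₁ (decodes σ)) ⟩
    inorder (heapOf σ)                ≡⟨ inorder-heapOf σ ⟩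
    word σ                            ∎
    where open ≡-Reasoning

  Ψ-surjective : (T : BT n) → Σ (DU n) λ π → Ψ π ≈B T
  Ψ-surjective T with build-ok T n 1≤n ≤-refl
  ... | treeOn (it , u) _ bags , same with encode-ok (build (parent (tree T)) n) it u
  ... | (_ , dx) , hx = π , λ j 2≤j j≤n → trans (cong (λ z → parentOf z j) treeOfDU≡t) (same j 2≤j j≤n)
    where
    t = build (parent (tree T)) n
    x = encode t
    labels : count (inorder x) ≗ count [ n ]
    labels a = trans (bag-encode t a) (bags a)
    π : DU n
    π = record { word = inorder x ; isPerm = count≗⇒↭ (inorder x) [ n ] labels ; downUp = Down-inorder dx hx }
    heapOf≡x : heapOf π ≡ x
    heapOf≡x = inorder-injective (heapOf π) x (Heap-heapOf π) hx (inorder-heapOf π)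
    order≤size : order t ≤ size x
    order≤size = ≤-reflexive (count≗⇒length≡ (vertices t) (inorder x) (λ a → sym (bag-encode t a)))
    treeOfDU≡t : treeOfDU π ≡ t
    treeOfDU≡t = trans (cong (λ z → decode (size z) z) heapOf≡x) (decode-encode t (size x) it u order≤size)

  Ψ-leaf : (π : DU n) → Σ ℕ λ a → Σ (List ℕ) λ rest → (word π ≡ a ∷ rest) × LeafIs (Ψ π) a
  Ψ-leaf π with inorder-head (TreeOf.alt (reading π)) (IsNode-heapOf π)
  ... | rest , e = leftmost (heapOf π) , rest , trans (sym (inorder-heapOf π)) e ,
    subst (MinPathEnd (ToBT.incTree n (treeOfDU π) (treeOfDU-on π)) 1) (proj₂ (proj₂ (decodes π))) (ToBT.minPath-root n (treeOfDU π) (treeOfDU-on π))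

theorem3 : (n : ℕ) → 1 ≤ n →
    Σ (DU n → BT n) λ Ψ →
      ((π σ : DU n) → word π ≡ word σ → Ψ π ≈B Ψ σ)
      × ((π σ : DU n) → Ψ π ≈B Ψ σ → word π ≡ word σ)
      × ((T : BT n) → Σ (DU n) λ π → Ψ π ≈B T)
      × ((π : DU n) → Σ ℕ λ a → Σ (List ℕ) λ rest →
           (word π ≡ a ∷ rest) × LeafIs (Ψ π) a)
theorem3 n 1≤n = Ψ , Ψ-cong , Ψ-injective , Ψ-surjective , Ψ-leaf
  where open Bijection n 1≤n
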